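{- Let $n\ge 2$. Let $t_1,t_2$ be two ranked trees of size $n$ generated independently by the coalescent process. Then the probability $p_n$ that $t_1$ and $t_2$ are identical is $$p_n=\frac{4^{n-1}}{(n-1)!}\,[z^{n-1}]\,Y\!\left(\tfrac14,z\right),$$ where $Y(x,z)=\sum_{t\in\mathcal R,\ n(t)\ge 2}\frac{x^{o(t)}z^{n(t)-1}}{(n(t)-1)!}$ and $[z^{k}]$ denotes the coefficient of $z^k$ in the Taylor expansion at $z=0$.
   Context: A ranked tree of size $n$ is a rooted binary unordered tree (every node has outdegree $0$ or $2$) with $n$ leaves (outdegree-$0$ nodes; the leaves are unlabeled) whose $n-1$ internal nodes carry distinct labels from $\{1,\dots,n-1\}$ such that every internal child has a larger label than its parent; trees are considered up to label-preserving isomorphism. $\mathcal R$ denotes the set of all ranked trees, $n(t)$ the number of leaves of $t$, and $o(t)$ the number of cherries of $t$, i.e. internal nodes both of whose children are leaves. The coalescent process of size $n$ starts with $n$ lineages (leaves) and repeatedly merges a uniformly random pair of the current lineages into a new internal node until one lineage remains; internal nodes are ranked by the time of creation (the last merger, the root, gets label $1$, the first merger gets label $n-1$). Known fact (Tajima): under this process a ranked tree $t$ of size $n$ is obtained with probability $2^{n-1-o(t)}/(n-1)!$. -}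

module Defs where

open import Data.Nat as ℕ using (ℕ; zero; suc; _∸_; _≡ᵇ_; _≤ᵇ_; _!)
open import Data.Integer using (+_)
open import Data.Rational as ℚ using (ℚ; _/_; 0ℚ; 1ℚ)
open import Data.Bool using (Bool; true; false; if_then_else_; _∧_)
open import Data.List using (List; []; _∷_; _++_; [_]; map; concatMap; length; filter; upTo; foldr; sum; allFin)
open import Data.Product using (_×_; _,_)
open import Relation.Nullary.Decidable using (does)
open import Data.List.Properties using (≡-dec)

-- a / b as a rational; the (never used) case b = 0 is sent to 0.
_÷ℕ_ : ℕ → ℕ → ℚ
a ÷ℕ zero = 0ℚ
a ÷ℕ suc b = (+ a) / suc b

_^ℚ_ : ℚ → ℕ → ℚ
x ^ℚ zero = 1ℚ
x ^ℚ suc k = x ℚ.* (x ^ℚ k)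

sumℚ : List ℚ → ℚ
sumℚ = foldr ℚ._+_ 0ℚ

range : ℕ → ℕ → List ℕ
range a b = map (ℕ._+ a) (upTo (suc b ∸ a))

countℕ : ℕ → List ℕ → ℕ
countℕ j xs = length (filter (λ y → j ℕ.≟ y) xs)

-- A ranked tree of size n (n ≥ 2) is, up to label-preserving isomorphism,
-- determined by the parent label of each non-root internal node:
-- it is encoded by the list  [par 2, par 3, ..., par (n-1)]  where
-- 1 ≤ par i < i, and each internal node has at most two internal
-- children (its remaining children are leaves).

candidates : ℕ → List (List ℕ)
candidates zero    = [ [] ]
candidates (suc m) = concatMap (λ ps → map (λ p → ps ++ [ p ]) (range 1 (suc m))) (candidates m)

atMostTwoChildren : List ℕ → Bool
atMostTwoChildren ps = foldr _∧_ true (map (λ j → countℕ j ps ≤ᵇ 2) ps)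

rankedTrees : ℕ → List (List ℕ)
rankedTrees n = filter (λ ps → Data.Bool._≟_ (atMostTwoChildren ps) true) (candidates (n ∸ 2))
  where import Data.Bool

-- o(t): number of cherries = internal nodes (labels 1..n-1) without
-- internal children.
cherries : ℕ → List ℕ → ℕ
cherries n ps = length (filter (λ j → countℕ j ps ℕ.≟ 0) (range 1 (n ∸ 1)))

data Lin : Set where
  leafL : Lin
  nodeL : ℕ → Lin

nth : List Lin → ℕ → Lin
nth []       _       = leafL
nth (x ∷ xs) zero    = x
nth (x ∷ xs) (suc i) = nth xs i

dropAt : {A : Set} → ℕ → List A → List A
dropAt _       []       = []
dropAt zero    (x ∷ xs) = xs
dropAt (suc i) (x ∷ xs) = x ∷ dropAt i xs

pairs : ℕ → List (ℕ × ℕ)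
pairs k = concatMap (λ j → map (λ i → i , j) (upTo j)) (upTo k)

edgeOf : Lin → ℕ → List (ℕ × ℕ)
edgeOf leafL     p = []
edgeOf (nodeL c) p = [ (c , p) ]

-- All complete runs of the process: from the lineage list ls, perform
-- `fuel` mergers; at each step with k lineages each of the C(k,2) pairs
-- is one branch (all equally likely), the new node gets label k-1.
-- Returns, for every run (with multiplicity), the accumulated edge list.
runs : ℕ → List Lin → List (ℕ × ℕ) → List (List (ℕ × ℕ))
runs zero    ls acc = [ acc ]
runs (suc f) ls acc = concatMap branch (pairs (length ls))
  where
  branch : ℕ × ℕ → List (List (ℕ × ℕ))
  branch (i , j) =
    let k = length ls
        lab = k ∸ 1
        ls' = dropAt i (dropAt j ls) ++ [ nodeL lab ]
    in runs f ls' (acc ++ edgeOf (nth ls i) lab ++ edgeOf (nth ls j) lab)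

replicateL : ℕ → List Lin
replicateL zero    = []
replicateL (suc n) = leafL ∷ replicateL n

parentOf : ℕ → List (ℕ × ℕ) → ℕ
parentOf c []             = 0
parentOf c ((x , p) ∷ es) = if x ≡ᵇ c then p else parentOf c es

treeOf : ℕ → List (ℕ × ℕ) → List ℕ
treeOf n es = map (λ c → parentOf c es) (range 2 (n ∸ 1))

coalescentOutcomes : ℕ → List (List ℕ)
coalescentOutcomes n = map (treeOf n) (runs (n ∸ 1) (replicateL n) [])

-- probability that two independent coalescent trees of size n coincide:
-- (# pairs of runs giving the same ranked tree) / (# runs)^2
pIdentical : ℕ → ℚ
pIdentical n =
  let os = coalescentOutcomes n
      N  = length os
      same = length (concatMap (λ a → filter (λ b → ≡-dec ℕ._≟_ a b) os) os)
  in same ÷ℕ (N ℕ.* N)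

-- Y(x,z) = Σ_{t ∈ R, n(t) ≥ 2} x^{o(t)} z^{n(t)-1} / (n(t)-1)!
-- coeffY x k = [z^k] Y(x,z)  (the trees with n(t) - 1 = k)

coeffY : ℚ → ℕ → ℚ
coeffY x zero    = 0ℚ
coeffY x (suc m) =
  sumℚ (map (λ t → (x ^ℚ cherries (suc (suc m)) t) ℚ.* (1 ÷ℕ ((suc m) !)))
            (rankedTrees (suc (suc m))))

-- A run of the coalescent with k lineages has C(k,2) choices for its next merger, so there are
-- n!(n−1)!/2^(n−1) equally likely runs.  A run yields the ranked tree t iff every merger joins the
-- children in t of the label it creates.  Going through the labels n−1, …, 1 with ℓ leaves left,
-- a merger of two leaves (a cherry of t) can be chosen in C(ℓ,2) ways, one of a leaf and a node in
-- ℓ ways and one of two nodes in one way; hence t arises from exactly n!/2^o(t) runs, and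
-- p_n = Σ_t (n!/2^o(t))² / (n!(n−1)!/2^(n−1))², which is the stated coefficient.

module Submission where

open import Defs

open import Data.Bool as Bool using (Bool; true; false; T; if_then_else_)
open import Data.Bool.Properties using (T-≡)
open import Data.Empty using (⊥; ⊥-elim)
import Data.Integer as ℤ
open import Data.Integer.Properties using (pos-*; pos-+)
open import Data.List using (List; []; _∷_; [_]; _++_; replicate; map; concatMap; length; filter; upTo)
open import Data.List.Membership.Propositional using (_∈_; _∉_; find; lose)
open import Data.List.Membership.Propositional.Properties
  using (∈-++⁺ˡ; ∈-++⁺ʳ; ∈-++⁻; ∈-map⁺; ∈-map⁻; ∈-upTo⁺; ∈-upTo⁻; ∈-concatMap⁺; ∈-concatMap⁻; ∈-filter⁺; ∈-filter⁻)
open import Data.List.Membership.Propositional.Properties.WithK using (unique∧set⇒bag)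
open import Data.List.Properties
  using (filter-accept; filter-reject; filter-all; filter-none; filter-++; length-replicate; length-++; length-map;
         map-upTo; map-applyUpTo; map-cong; map-++; concatMap-cong; upTo-∷ʳ; ++-assoc; ++-identityʳ; ∷-injective; ∷ʳ-injective; ≡-dec)
import Data.List.Properties as ListProp
open import Data.List.Relation.Binary.BagAndSetEquality using (∼bag⇒↭)
open import Data.List.Relation.Binary.Disjoint.Propositional using (Disjoint)
open import Data.List.Relation.Binary.Permutation.Propositional
  using (_↭_; prep; swap; ↭-sym; ↭⇒↭ₛ) renaming (refl to prefl; trans to ptrans)
open import Data.List.Relation.Binary.Permutation.Propositional.Properties using (shift; ∈-resp-↭; ↭-length; filter-↭)
import Data.List.Relation.Binary.Permutation.Setoid.Properties as PermSetoid
open import Data.List.Relation.Unary.All as All using (All; []; _∷_)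
import Data.List.Relation.Unary.All.Properties as AllProp
open import Data.List.Relation.Unary.AllPairs as AP using ([]; _∷_)
import Data.List.Relation.Unary.AllPairs.Properties as APProp
open import Data.List.Relation.Unary.Any as Any using (Any; here; there)
open import Data.List.Relation.Unary.Any.Properties using (++⁺ˡ; ++⁺ʳ; ++⁻)
open import Data.List.Relation.Unary.Unique.Propositional using (Unique)
import Data.List.Relation.Unary.Unique.Propositional.Properties as UP
open import Data.Nat as ℕ
  using (ℕ; zero; suc; pred; _+_; _*_; _∸_; _^_; _!; _≤_; _<_; z≤n; s≤s; _≤?_; _<?_; _≟_; _≡ᵇ_; _≤ᵇ_; ≢-nonZero; ≢-nonZero⁻¹)
open import Data.Nat.ListAction using (sum)
open import Data.Nat.ListAction.Properties using (sum-++)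
open import Data.Nat.Properties
open import Data.Nat.Tactic.RingSolver using (solve-∀)
open import Data.Product using (Σ; _×_; _,_; proj₁; proj₂)
open import Data.Rational as ℚ using (ℚ; 0ℚ; toℚᵘ)
open import Data.Rational.Properties using (toℚᵘ-homo-*; toℚᵘ-homo-+; toℚᵘ-fromℚᵘ; toℚᵘ-injective)
open import Data.Rational.Unnormalised using (mkℚᵘ; *≡*) renaming (_≃_ to _≃ᵘ_)
open import Data.Rational.Unnormalised.Properties using (≃-refl; ≃-sym; ≃-trans; ≃-reflexive; *-cong; +-cong)
open import Data.Sum using (_⊎_; inj₁; inj₂)
import Data.Sum as Sum
open import Data.Unit using (⊤; tt)
open import Function using (_∘_)
open import Function.Bundles using (mk⇔; Equivalence)
open import Level using (0ℓ)
open import Relation.Binary.Definitions using (DecidableEquality)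
open import Relation.Binary.PropositionalEquality hiding ([_])
open import Relation.Nullary using (Dec; yes; no; ¬_)
open import Relation.Nullary.Decidable using (¬?; decidable-stable)
open import Relation.Unary using (Pred; Decidable)

open import Data.List.Membership.DecPropositional (≡-dec _≟_) using (_∈?_)
open import Data.List.Membership.DecPropositional _≟_ using () renaming (_∈?_ to _∈ℕ?_)
open import Algebra.Properties.CommutativeSemigroup +-commutativeSemigroup using (interchange; xy∙z≈xz∙y)

private
  variable
    A B : Set

choose₂ : ℕ → ℕ
choose₂ zero    = 0
choose₂ (suc l) = l + choose₂ l

2*choose₂ : ∀ l → 2 * choose₂ (suc l) ≡ suc l * l
2*choose₂ zero    = refl
2*choose₂ (suc l) = begin
  2 * (suc l + choose₂ (suc l))     ≡⟨ *-distribˡ-+ 2 (suc l) (choose₂ (suc l)) ⟩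
  2 * suc l + 2 * choose₂ (suc l)   ≡⟨ cong (2 * suc l +_) (2*choose₂ l) ⟩
  2 * suc l + suc l * l             ≡⟨ expand l ⟩
  suc (suc l) * suc l               ∎
  where
  open ≡-Reasoning
  expand : ∀ l → 2 * suc l + suc l * l ≡ suc (suc l) * suc l
  expand = solve-∀

choose₂-vanishing : ∀ {ℓ} → ¬ 2 ≤ ℓ → choose₂ ℓ ≡ 0
choose₂-vanishing {zero}        _   = refl
choose₂-vanishing {suc zero}    _   = refl
choose₂-vanishing {suc (suc l)} ℓ≱2 = ⊥-elim (ℓ≱2 (s≤s (s≤s z≤n)))

choose₂*-vanishing : ∀ ℓ {X} → (2 ≤ ℓ → X ≡ 0) → choose₂ ℓ * X ≡ 0
choose₂*-vanishing ℓ {X} h with 2 ≤? ℓ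
... | yes ℓ≥2 = trans (cong (choose₂ ℓ *_) (h ℓ≥2)) (*-zeroʳ (choose₂ ℓ))
... | no  ℓ≱2 = cong (_* X) (choose₂-vanishing ℓ≱2)

*-vanishing : ∀ ℓ {X} → (1 ≤ ℓ → X ≡ 0) → ℓ * X ≡ 0
*-vanishing zero    h = refl
*-vanishing (suc l) h = trans (cong (suc l *_) (h (s≤s z≤n))) (*-zeroʳ (suc l))

pred+2 : ∀ {ℓ} → 1 ≤ ℓ → pred ℓ + 2 ≡ ℓ + 1
pred+2 {suc l} _ = trans (+-comm l 2) (cong suc (+-comm 1 l))

choose₂-factorial : ∀ ℓ X Y → 2 ≤ ℓ → X * Y ≡ (ℓ ∸ 2) ! → choose₂ ℓ * X * (2 * Y) ≡ ℓ !
choose₂-factorial (suc (suc l)) X Y _ e = begin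
  choose₂ (suc (suc l)) * X * (2 * Y)    ≡⟨ regroup (choose₂ (suc (suc l))) X Y ⟩
  2 * choose₂ (suc (suc l)) * (X * Y)    ≡⟨ cong₂ _*_ (2*choose₂ (suc l)) e ⟩
  suc (suc l) * suc l * l !              ≡⟨ *-assoc (suc (suc l)) (suc l) (l !) ⟩
  suc (suc l) * (suc l * l !)            ∎
  where
  open ≡-Reasoning
  regroup : ∀ t X Y → t * X * (2 * Y) ≡ 2 * t * (X * Y)
  regroup = solve-∀
choose₂-factorial (suc zero) X Y (s≤s ()) _

*-factorial : ∀ ℓ X Y → 1 ≤ ℓ → X * Y ≡ (pred ℓ) ! → ℓ * X * Y ≡ ℓ !
*-factorial (suc l) X Y _ e = trans (*-assoc (suc l) X Y) (cong (suc l *_) e)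

2*suc : ∀ f → 2 * suc f ≡ suc (suc (2 * f))
2*suc = solve-∀

4^≡2^*2^ : ∀ o → 4 ^ o ≡ 2 ^ o * 2 ^ o
4^≡2^*2^ zero    = refl
4^≡2^*2^ (suc o) = trans (cong (4 *_) (4^≡2^*2^ o)) (regroup (2 ^ o))
  where
  regroup : ∀ x → 4 * (x * x) ≡ 2 * x * (2 * x)
  regroup = solve-∀

n!≢0 : ∀ k → k ! ≢ 0
n!≢0 k = ≢-nonZero⁻¹ (k !) {{k !≢0}}

*≢0 : ∀ {a b} → a ≢ 0 → b ≢ 0 → a * b ≢ 0
*≢0 {a} {b} a≢0 b≢0 = ≢-nonZero⁻¹ (a * b) {{m*n≢0 a b {{≢-nonZero a≢0}} {{≢-nonZero b≢0}}}}

-- sumSelect₁ g xs = Σᵢ g (xs without xᵢ) xᵢ  and  sumSelect₂ g xs = Σ_{i<j} g (xs without xᵢ, xⱼ) xᵢ xⱼ.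
sumSelect₁ : (List A → A → ℕ) → List A → ℕ
sumSelect₁ g []       = 0
sumSelect₁ g (x ∷ xs) = g xs x + sumSelect₁ (λ B s → g (x ∷ B) s) xs

sumSelect₂ : (List A → A → A → ℕ) → List A → ℕ
sumSelect₂ g []       = 0
sumSelect₂ g (x ∷ xs) = sumSelect₁ (λ B q → g B x q) xs + sumSelect₂ (λ B r q → g (x ∷ B) r q) xs

sumSelect₁-cong : {g h : List A → A → ℕ} → (∀ B s → g B s ≡ h B s) → ∀ xs → sumSelect₁ g xs ≡ sumSelect₁ h xs
sumSelect₁-cong e []       = refl
sumSelect₁-cong e (x ∷ xs) = cong₂ _+_ (e xs x) (sumSelect₁-cong (λ B s → e (x ∷ B) s) xs)

sumSelect₂-cong : {g h : List A → A → A → ℕ} → (∀ B r q → g B r q ≡ h B r q) → ∀ xs → sumSelect₂ g xs ≡ sumSelect₂ h xs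
sumSelect₂-cong e []       = refl
sumSelect₂-cong e (x ∷ xs) = cong₂ _+_ (sumSelect₁-cong (λ B q → e B x q) xs) (sumSelect₂-cong (λ B r q → e (x ∷ B) r q) xs)

sumSelect₁-map : (f : A → B) (g : List B → B → ℕ) (xs : List A) →
  sumSelect₁ g (map f xs) ≡ sumSelect₁ (λ C s → g (map f C) (f s)) xs
sumSelect₁-map f g []       = refl
sumSelect₁-map f g (x ∷ xs) = cong (g (map f xs) (f x) +_) (sumSelect₁-map f (λ C s → g (f x ∷ C) s) xs)

sumSelect₂-map : (f : A → B) (g : List B → B → B → ℕ) (xs : List A) →
  sumSelect₂ g (map f xs) ≡ sumSelect₂ (λ C r q → g (map f C) (f r) (f q)) xs
sumSelect₂-map f g []       = refl
sumSelect₂-map f g (x ∷ xs) = cong₂ _+_ (sumSelect₁-map f (λ C q → g C (f x) q) xs) (sumSelect₂-map f (λ C r q → g (f x ∷ C) r q) xs)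

sumSelect₁-replicate : (g : List A → A → ℕ) (x : A) (ℓ : ℕ) (ys : List A) →
  sumSelect₁ g (replicate ℓ x ++ ys) ≡ ℓ * g (replicate (pred ℓ) x ++ ys) x + sumSelect₁ (λ B y → g (replicate ℓ x ++ B) y) ys
sumSelect₁-replicate g x zero          ys = refl
sumSelect₁-replicate g x (suc zero)    ys = cong (_+ sumSelect₁ (λ B y → g (x ∷ B) y) ys) (sym (+-identityʳ (g ys x)))
sumSelect₁-replicate g x (suc (suc l)) ys =
  trans (cong (g (replicate (suc l) x ++ ys) x +_) (sumSelect₁-replicate (λ B s → g (x ∷ B) s) x (suc l) ys))
        (sym (+-assoc (g (replicate (suc l) x ++ ys) x) _ _))

sumSelect₂-replicate : {A : Set} (g : List A → A → A → ℕ) (x : A) (ℓ : ℕ) (ys : List A) →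
  sumSelect₂ g (replicate ℓ x ++ ys) ≡ choose₂ ℓ * g (replicate (ℓ ∸ 2) x ++ ys) x x
                                     + ℓ * sumSelect₁ (λ B q → g (replicate (pred ℓ) x ++ B) x q) ys
                                     + sumSelect₂ (λ B r q → g (replicate ℓ x ++ B) r q) ys
sumSelect₂-replicate g x zero    ys = refl
sumSelect₂-replicate {A} g x (suc l) ys = begin
  sumSelect₁ (λ B q → g B x q) (replicate l x ++ ys) + sumSelect₂ g′ (replicate l x ++ ys)
    ≡⟨ cong₂ _+_ (sumSelect₁-replicate (λ B q → g B x q) x l ys) (sumSelect₂-replicate g′ x l ys) ⟩
  (l * g₀ + S₁) + (choose₂ l * g′ (replicate (l ∸ 2) x ++ ys) x x + l * S₁′ + D)
    ≡⟨ cong₂ (λ u v → (l * g₀ + S₁) + (u + v + D)) (leafPair l) (leafSingle l) ⟩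
  (l * g₀ + S₁) + (choose₂ l * g₀ + l * S₁ + D)
    ≡⟨ regroup l (choose₂ l) g₀ S₁ D ⟩
  (l + choose₂ l) * g₀ + suc l * S₁ + D ∎
  where
  open ≡-Reasoning
  g′ : List A → A → A → ℕ
  g′ B r q = g (x ∷ B) r q
  g₀ S₁ S₁′ D : ℕ
  g₀  = g (replicate (pred l) x ++ ys) x x
  S₁  = sumSelect₁ (λ B q → g (replicate l x ++ B) x q) ys
  S₁′ = sumSelect₁ (λ B q → g′ (replicate (pred l) x ++ B) x q) ys
  D   = sumSelect₂ (λ B r q → g (replicate (suc l) x ++ B) r q) ys
  regroup : ∀ l t a s d → (l * a + s) + (t * a + l * s + d) ≡ (l + t) * a + suc l * s + d
  regroup = solve-∀
  leafPair : ∀ l → choose₂ l * g′ (replicate (l ∸ 2) x ++ ys) x x ≡ choose₂ l * g (replicate (pred l) x ++ ys) x x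
  leafPair zero          = refl
  leafPair (suc zero)    = refl
  leafPair (suc (suc k)) = refl
  leafSingle : ∀ l → l * sumSelect₁ (λ B q → g′ (replicate (pred l) x ++ B) x q) ys
                   ≡ l * sumSelect₁ (λ B q → g (replicate l x ++ B) x q) ys
  leafSingle zero    = refl
  leafSingle (suc k) = refl

sum-map-+ : (f g : A → ℕ) (xs : List A) → sum (map (λ x → f x + g x) xs) ≡ sum (map f xs) + sum (map g xs)
sum-map-+ f g []       = refl
sum-map-+ f g (x ∷ xs) = trans (cong (f x + g x +_) (sum-map-+ f g xs)) (interchange (f x) (g x) _ _)

sum-map-cong : {f g : A → ℕ} → (∀ x → f x ≡ g x) → ∀ xs → sum (map f xs) ≡ sum (map g xs)
sum-map-cong e xs = cong sum (map-cong e xs)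

sum-map-∘ : (f : B → ℕ) (g : A → B) (xs : List A) → sum (map f (map g xs)) ≡ sum (map (λ x → f (g x)) xs)
sum-map-∘ f g xs = cong sum (sym (ListProp.map-∘ xs))

sum-concatMap : (G : B → ℕ) (h : A → List B) (xs : List A) →
  sum (map G (concatMap h xs)) ≡ sum (map (λ x → sum (map G (h x))) xs)
sum-concatMap G h []       = refl
sum-concatMap G h (x ∷ xs) = begin
  sum (map G (h x ++ concatMap h xs))               ≡⟨ cong sum (map-++ G (h x) (concatMap h xs)) ⟩
  sum (map G (h x) ++ map G (concatMap h xs))       ≡⟨ sum-++ (map G (h x)) _ ⟩
  sum (map G (h x)) + sum (map G (concatMap h xs))  ≡⟨ cong (sum (map G (h x)) +_) (sum-concatMap G h xs) ⟩
  _                                                 ∎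
  where open ≡-Reasoning

sum-upTo-suc : (h : ℕ → ℕ) (k : ℕ) → sum (map h (upTo (suc k))) ≡ h 0 + sum (map (λ j → h (suc j)) (upTo k))
sum-upTo-suc h k = cong (h 0 +_) (trans (cong (λ z → sum (map h z)) (sym (map-upTo suc k))) (sum-map-∘ h suc (upTo k)))

sum-pairs-suc : (G : ℕ × ℕ → ℕ) (k : ℕ) →
  sum (map G (pairs (suc k))) ≡ sum (map (λ j → G (0 , suc j)) (upTo k)) + sum (map (λ p → G (suc (proj₁ p) , suc (proj₂ p))) (pairs k))
sum-pairs-suc G k = begin
  sum (map G (pairs (suc k)))                                   ≡⟨ sum-concatMap G below (upTo (suc k)) ⟩
  sum (map (λ j → sum (map G (below j))) (upTo (suc k)))        ≡⟨ sum-upTo-suc (λ j → sum (map G (below j))) k ⟩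
  sum (map (λ j → sum (map G (below (suc j)))) (upTo k))        ≡⟨ sum-map-cong splitFirst (upTo k) ⟩
  sum (map (λ j → G (0 , suc j) + inner j) (upTo k))            ≡⟨ sum-map-+ (λ j → G (0 , suc j)) inner (upTo k) ⟩
  sum (map (λ j → G (0 , suc j)) (upTo k)) + sum (map inner (upTo k))
    ≡⟨ cong (sum (map (λ j → G (0 , suc j)) (upTo k)) +_) (sym shifted) ⟩
  sum (map (λ j → G (0 , suc j)) (upTo k)) + sum (map G′ (pairs k)) ∎
  where
  open ≡-Reasoning
  below : ℕ → List (ℕ × ℕ)
  below j = map (λ i → i , j) (upTo j)
  G′ : ℕ × ℕ → ℕ
  G′ p = G (suc (proj₁ p) , suc (proj₂ p))
  inner : ℕ → ℕ
  inner j = sum (map (λ i → G (suc i , suc j)) (upTo j))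
  splitFirst : ∀ j → sum (map G (below (suc j))) ≡ G (0 , suc j) + inner j
  splitFirst j = trans (sum-map-∘ G (λ i → i , suc j) (upTo (suc j))) (sum-upTo-suc (λ i → G (i , suc j)) j)
  shifted : sum (map G′ (pairs k)) ≡ sum (map inner (upTo k))
  shifted = trans (sum-concatMap G′ below (upTo k)) (sum-map-cong (λ j → sum-map-∘ G′ (λ i → i , j) (upTo j)) (upTo k))

map-≡⇒pointwise : (f g : A → ℕ) (xs : List A) → map f xs ≡ map g xs → ∀ {c} → c ∈ xs → f c ≡ g c
map-≡⇒pointwise f g (x ∷ xs) e (here refl) = proj₁ (∷-injective e)
map-≡⇒pointwise f g (x ∷ xs) e (there c∈) = map-≡⇒pointwise f g xs (proj₂ (∷-injective e)) c∈

pointwise⇒map-≡ : (f g : A → ℕ) (xs : List A) → (∀ {c} → c ∈ xs → f c ≡ g c) → map f xs ≡ map g xs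
pointwise⇒map-≡ f g []       h = refl
pointwise⇒map-≡ f g (x ∷ xs) h = cong₂ _∷_ (h (here refl)) (pointwise⇒map-≡ f g xs (λ c∈ → h (there c∈)))

sum-upTo≡sumSelect₁ : (h : List Lin → Lin → ℕ) (ls : List Lin) →
  sum (map (λ j → h (dropAt j ls) (nth ls j)) (upTo (length ls))) ≡ sumSelect₁ h ls
sum-upTo≡sumSelect₁ h []       = refl
sum-upTo≡sumSelect₁ h (x ∷ xs) =
  trans (sum-upTo-suc (λ j → h (dropAt j (x ∷ xs)) (nth (x ∷ xs) j)) (length xs))
        (cong (h xs x +_) (sum-upTo≡sumSelect₁ (λ B s → h (x ∷ B) s) xs))

sum-pairs≡sumSelect₂ : (g : List Lin → Lin → Lin → ℕ) (ls : List Lin) →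
  sum (map (λ p → g (dropAt (proj₁ p) (dropAt (proj₂ p) ls)) (nth ls (proj₁ p)) (nth ls (proj₂ p))) (pairs (length ls)))
  ≡ sumSelect₂ g ls
sum-pairs≡sumSelect₂ g []       = refl
sum-pairs≡sumSelect₂ g (x ∷ xs) =
  trans (sum-pairs-suc (λ p → g (dropAt (proj₁ p) (dropAt (proj₂ p) (x ∷ xs))) (nth (x ∷ xs) (proj₁ p)) (nth (x ∷ xs) (proj₂ p))) (length xs))
        (cong₂ _+_ (sum-upTo≡sumSelect₁ (λ B q → g B x q) xs) (sum-pairs≡sumSelect₂ (λ B r q → g (x ∷ B) r q) xs))

-- Runs of the coalescent process

runs-suc : ∀ f ls acc → runs (suc f) ls acc ≡
  concatMap (λ p → runs f (dropAt (proj₁ p) (dropAt (proj₂ p) ls) ++ [ nodeL (length ls ∸ 1) ])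
                         (acc ++ edgeOf (nth ls (proj₁ p)) (length ls ∸ 1) ++ edgeOf (nth ls (proj₂ p)) (length ls ∸ 1)))
            (pairs (length ls))
runs-suc f ls acc = concatMap-cong (λ { (i , j) → refl }) (pairs (length ls))

state : ℕ → List ℕ → List Lin
state ℓ S = replicate ℓ leafL ++ map nodeL S

length-state : ∀ ℓ S → length (state ℓ S) ≡ ℓ + length S
length-state ℓ S = trans (length-++ (replicate ℓ leafL)) (cong₂ _+_ (length-replicate ℓ) (length-map nodeL S))

state-snoc : ∀ ℓ S lab → replicate ℓ leafL ++ map nodeL S ++ [ nodeL lab ] ≡ state ℓ (S ++ [ lab ])
state-snoc ℓ S lab = cong (replicate ℓ leafL ++_) (sym (map-++ nodeL S [ lab ]))

module RunCount {Q : Pred (List (ℕ × ℕ)) 0ℓ} (Q? : Decidable Q) where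

  count : List (List (ℕ × ℕ)) → ℕ
  count xs = length (filter Q? xs)

  count-++ : ∀ xs ys → count (xs ++ ys) ≡ count xs + count ys
  count-++ xs ys = trans (cong length (filter-++ Q? xs ys)) (length-++ (filter Q? xs))

  count-concatMap : (h : A → List (List (ℕ × ℕ))) (xs : List A) → count (concatMap h xs) ≡ sum (map (λ x → count (h x)) xs)
  count-concatMap h []       = refl
  count-concatMap h (x ∷ xs) = trans (count-++ (h x) (concatMap h xs)) (cong (count (h x) +_) (count-concatMap h xs))

  countRuns : ℕ → List Lin → List (ℕ × ℕ) → ℕ
  countRuns f ls acc = count (runs f ls acc)

  countRuns-suc : ∀ f ls acc → countRuns (suc f) ls acc ≡
    sumSelect₂ (λ B a b → countRuns f (B ++ [ nodeL (length ls ∸ 1) ]) (acc ++ edgeOf a (length ls ∸ 1) ++ edgeOf b (length ls ∸ 1))) ls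
  countRuns-suc f ls acc = trans (cong count (runs-suc f ls acc))
    (trans (count-concatMap _ (pairs (length ls)))
      (sum-pairs≡sumSelect₂ (λ B a b → countRuns f (B ++ [ nodeL (length ls ∸ 1) ]) (acc ++ edgeOf a (length ls ∸ 1) ++ edgeOf b (length ls ∸ 1))) ls))

  countFrom : ℕ → ℕ → List ℕ → List (ℕ × ℕ) → ℕ
  countFrom f ℓ S acc = countRuns f (state ℓ S) acc

  countFrom-zero-yes : ∀ ℓ S {acc} → Q acc → countFrom 0 ℓ S acc ≡ 1
  countFrom-zero-yes _ _ q = cong length (filter-accept Q? q)

  countFrom-zero-no : ∀ ℓ S {acc} → ¬ Q acc → countFrom 0 ℓ S acc ≡ 0
  countFrom-zero-no _ _ ¬q = cong length (filter-reject Q? ¬q)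

  -- The three kinds of merger creating the node lab: two leaves, a leaf and a node, two nodes.
  mergeExpansion : ℕ → ℕ → List ℕ → List (ℕ × ℕ) → ℕ → ℕ
  mergeExpansion f ℓ S acc lab =
      choose₂ ℓ * countFrom f (ℓ ∸ 2) (S ++ [ lab ]) acc
    + ℓ * sumSelect₁ (λ B s → countFrom f (pred ℓ) (B ++ [ lab ]) (acc ++ [ (s , lab) ])) S
    + sumSelect₂ (λ B r q → countFrom f ℓ (B ++ [ lab ]) (acc ++ (r , lab) ∷ (q , lab) ∷ [])) S

  countFrom-suc : ∀ f ℓ S acc → countFrom (suc f) ℓ S acc ≡ mergeExpansion f ℓ S acc (ℓ + length S ∸ 1)
  countFrom-suc f ℓ S acc = begin
    countRuns (suc f) (state ℓ S) acc              ≡⟨ countRuns-suc f (state ℓ S) acc ⟩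
    sumSelect₂ (g (length (state ℓ S) ∸ 1)) (state ℓ S)
      ≡⟨ cong (λ k → sumSelect₂ (g (k ∸ 1)) (state ℓ S)) (length-state ℓ S) ⟩
    sumSelect₂ (g lab) (state ℓ S)                 ≡⟨ sumSelect₂-replicate (g lab) leafL ℓ (map nodeL S) ⟩
    choose₂ ℓ * g lab (replicate (ℓ ∸ 2) leafL ++ map nodeL S) leafL leafL
      + ℓ * sumSelect₁ (λ B q → g lab (replicate (pred ℓ) leafL ++ B) leafL q) (map nodeL S)
      + sumSelect₂ (λ B r q → g lab (replicate ℓ leafL ++ B) r q) (map nodeL S)
      ≡⟨ cong₃-+ (cong (choose₂ ℓ *_) leafLeaf)
                 (cong (ℓ *_) (trans (sumSelect₁-map nodeL _ S) (sumSelect₁-cong leafNode S)))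
                 (trans (sumSelect₂-map nodeL _ S) (sumSelect₂-cong nodeNode S)) ⟩
    mergeExpansion f ℓ S acc lab                   ∎
    where
    open ≡-Reasoning
    lab : ℕ
    lab = ℓ + length S ∸ 1
    g : ℕ → List Lin → Lin → Lin → ℕ
    g k B a b = countRuns f (B ++ [ nodeL k ]) (acc ++ edgeOf a k ++ edgeOf b k)
    cong₃-+ : ∀ {a b c a′ b′ c′} → a ≡ a′ → b ≡ b′ → c ≡ c′ → a + b + c ≡ a′ + b′ + c′
    cong₃-+ refl refl refl = refl
    leafLeaf : g lab (replicate (ℓ ∸ 2) leafL ++ map nodeL S) leafL leafL ≡ countFrom f (ℓ ∸ 2) (S ++ [ lab ]) acc
    leafLeaf = cong₂ (countRuns f) (trans (++-assoc (replicate (ℓ ∸ 2) leafL) (map nodeL S) _) (state-snoc (ℓ ∸ 2) S lab)) (++-identityʳ acc)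
    leafNode : ∀ C s → g lab (replicate (pred ℓ) leafL ++ map nodeL C) leafL (nodeL s) ≡ countFrom f (pred ℓ) (C ++ [ lab ]) (acc ++ [ (s , lab) ])
    leafNode C s = cong (λ ls → countRuns f ls (acc ++ [ (s , lab) ])) (trans (++-assoc (replicate (pred ℓ) leafL) (map nodeL C) _) (state-snoc (pred ℓ) C lab))
    nodeNode : ∀ C r q → g lab (replicate ℓ leafL ++ map nodeL C) (nodeL r) (nodeL q) ≡ countFrom f ℓ (C ++ [ lab ]) (acc ++ (r , lab) ∷ (q , lab) ∷ [])
    nodeNode C r q = cong (λ ls → countRuns f ls (acc ++ (r , lab) ∷ (q , lab) ∷ [])) (trans (++-assoc (replicate ℓ leafL) (map nodeL C) _) (state-snoc ℓ C lab))

replicateL≡replicate : ∀ n → replicateL n ≡ replicate n leafL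
replicateL≡replicate zero    = refl
replicateL≡replicate (suc n) = cong (leafL ∷_) (replicateL≡replicate n)

runs≡state : ∀ f n → runs f (replicateL n) [] ≡ runs f (state n []) []
runs≡state f n = cong (λ ls → runs f ls []) (trans (replicateL≡replicate n) (sym (++-identityʳ _)))

Unique-resp-↭ : {xs ys : List A} → xs ↭ ys → Unique xs → Unique ys
Unique-resp-↭ {A = A} p = PermSetoid.Unique-resp-↭ (setoid A) (↭⇒↭ₛ p)

Unique-++⁻ʳ : (C : List A) {B : List A} → Unique (C ++ B) → Unique B
Unique-++⁻ʳ []      u       = u
Unique-++⁻ʳ (x ∷ C) (_ ∷ u) = Unique-++⁻ʳ C u

Unique-++-disjoint : (C : List A) {B : List A} → Unique (C ++ B) → ∀ {c} → c ∈ C → c ∈ B → ⊥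
Unique-++-disjoint (x ∷ C) (x∉ ∷ u) (here refl) c∈B = All.lookup (AllProp.++⁻ʳ C x∉) c∈B refl
Unique-++-disjoint (x ∷ C) (_  ∷ u) (there c∈C) c∈B = Unique-++-disjoint C u c∈C c∈B

Unique-∷ʳ : {B : List A} {y : A} → Unique B → y ∉ B → Unique (B ++ [ y ])
Unique-∷ʳ u y∉B = UP.++⁺ u ([] ∷ []) λ { (y∈B , here refl) → y∉B y∈B }

shift₂ : (x r q : A) (B : List A) → x ∷ r ∷ q ∷ B ↭ r ∷ q ∷ x ∷ B
shift₂ x r q B = ptrans (swap x r prefl) (prep r (swap x q prefl))

sumSelect₁-vanishing : (g : List A → A → ℕ) (S : List A) → (∀ B s → S ↭ s ∷ B → g B s ≡ 0) → sumSelect₁ g S ≡ 0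
sumSelect₁-vanishing g []       h = refl
sumSelect₁-vanishing g (x ∷ xs) h = cong₂ _+_ (h xs x prefl)
  (sumSelect₁-vanishing (λ B s → g (x ∷ B) s) xs (λ B s p → h (x ∷ B) s (ptrans (prep x p) (swap x s prefl))))

sumSelect₂-vanishing : (g : List A → A → A → ℕ) (S : List A) → (∀ B r q → S ↭ r ∷ q ∷ B → g B r q ≡ 0) → sumSelect₂ g S ≡ 0
sumSelect₂-vanishing g []       h = refl
sumSelect₂-vanishing g (x ∷ xs) h = cong₂ _+_
  (sumSelect₁-vanishing (λ B q → g B x q) xs (λ B q p → h B x q (prep x p)))
  (sumSelect₂-vanishing (λ B r q → g (x ∷ B) r q) xs (λ B r q p → h (x ∷ B) r q (ptrans (prep x p) (shift₂ x r q B))))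

module Partition {A : Set} {P : Pred A 0ℓ} (P? : Decidable P) where

  hits : List A → List A
  hits = filter P?

  misses : List A → List A
  misses = filter (λ x → ¬? (P? x))

  ↭-hits++misses : ∀ xs → xs ↭ hits xs ++ misses xs
  ↭-hits++misses []       = prefl
  ↭-hits++misses (x ∷ xs) with P? x
  ... | yes _ = prep x (↭-hits++misses xs)
  ... | no  _ = ptrans (prep x (↭-hits++misses xs)) (↭-sym (shift x (hits xs) (misses xs)))

  hits≡⇒↭++misses : ∀ S C → hits S ≡ C → S ↭ C ++ misses S
  hits≡⇒↭++misses S C e = subst (λ h → S ↭ h ++ misses S) e (↭-hits++misses S)

  all-misses : ∀ xs → All (λ x → ¬ P x) (misses xs)
  all-misses = AllProp.all-filter (λ x → ¬? (P? x))

  ∈-hits⁻ : ∀ {x} xs → x ∈ hits xs → x ∈ xs × P x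
  ∈-hits⁻ xs = ∈-filter⁻ P? {xs = xs}

  hits≡[]⇒none : ∀ S → hits S ≡ [] → ∀ {x} → x ∈ S → ¬ P x
  hits≡[]⇒none S e x∈S px with subst (_ ∈_) e (∈-filter⁺ P? x∈S px)
  ... | ()

  hits-nonempty⇒any : ∀ B → 0 < length (hits B) → Any P B
  hits-nonempty⇒any B len>0 with hits B in eq
  ... | y ∷ _ = let (y∈B , py) = ∈-hits⁻ B (subst (y ∈_) (sym eq) (here refl)) in lose y∈B py

  length-hits-↭ : ∀ {S} C B → S ↭ C ++ B → length (hits S) ≡ length (hits C) + length (hits B)
  length-hits-↭ C B perm = trans (↭-length (filter-↭ P? perm)) (trans (cong length (filter-++ P? C B)) (length-++ (hits C)))

  length-hits-↭∷ : ∀ {S x B} → S ↭ x ∷ B → P x → length (hits S) ≡ suc (length (hits B))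
  length-hits-↭∷ {x = x} {B} perm px = trans (length-hits-↭ (x ∷ []) B perm) (cong (λ h → length h + length (hits B)) (filter-accept P? px))

  length-hits-↭∷∷ : ∀ {S x y B} → S ↭ x ∷ y ∷ B → P x → P y → length (hits S) ≡ suc (suc (length (hits B)))
  length-hits-↭∷∷ {x = x} {y} {B} perm px py =
    trans (length-hits-↭ (x ∷ y ∷ []) B perm)
          (cong (λ h → length h + length (hits B)) (trans (filter-accept P? px) (cong (x ∷_) (filter-accept P? py))))

  sumSelect₁-single-hit : (g : List A → A → ℕ) (S : List A) (s₀ : A) → hits S ≡ s₀ ∷ [] →
    (∀ B x → S ↭ x ∷ B → (¬ P x ⊎ Any P B) → g B x ≡ 0) → sumSelect₁ g S ≡ g (misses S) s₀
  sumSelect₁-single-hit g (x ∷ xs) s₀ e h with P? x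
  ... | yes px = trans (cong₂ _+_ (cong₂ g (sym rest≡xs) (proj₁ (∷-injective e)))
                   (sumSelect₁-vanishing (λ B s → g (x ∷ B) s) xs (λ B s p → h (x ∷ B) s (ptrans (prep x p) (swap x s prefl)) (inj₂ (here px)))))
                   (+-identityʳ _)
    where
    rest≡xs : misses xs ≡ xs
    rest≡xs = filter-all (λ x → ¬? (P? x)) (All.tabulate (hits≡[]⇒none xs (proj₂ (∷-injective e))))
  ... | no ¬px =
    trans (cong (_+ sumSelect₁ (λ B s → g (x ∷ B) s) xs) (h xs x prefl (inj₁ ¬px)))
      (sumSelect₁-single-hit (λ B s → g (x ∷ B) s) xs s₀ e
        (λ B y p bad → h (x ∷ B) y (ptrans (prep x p) (swap x y prefl)) (Sum.map₂ there bad)))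

  sumSelect₂-two-hits : (g : List A → A → A → ℕ) (S : List A) (r₀ q₀ : A) → hits S ≡ r₀ ∷ q₀ ∷ [] →
    (∀ B x y → S ↭ x ∷ y ∷ B → (¬ P x ⊎ ¬ P y ⊎ Any P B) → g B x y ≡ 0) → sumSelect₂ g S ≡ g (misses S) r₀ q₀
  sumSelect₂-two-hits g (x ∷ xs) r₀ q₀ e h with P? x
  ... | yes px with proj₁ (∷-injective e)
  ...   | refl = trans (cong₂ _+_
            (sumSelect₁-single-hit (λ B q → g B x q) xs q₀ (proj₂ (∷-injective e)) (λ B y p bad → h B x y (prep x p) (inj₂ bad)))
            (sumSelect₂-vanishing (λ B r q → g (x ∷ B) r q) xs (λ B r q p → h (x ∷ B) r q (ptrans (prep x p) (shift₂ x r q B)) (inj₂ (inj₂ (here px))))))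
          (+-identityʳ _)
  sumSelect₂-two-hits g (x ∷ xs) r₀ q₀ e h | no ¬px = cong₂ _+_
    (sumSelect₁-vanishing (λ B q → g B x q) xs (λ B q p → h B x q (prep x p) (inj₁ ¬px)))
    (sumSelect₂-two-hits (λ B r q → g (x ∷ B) r q) xs r₀ q₀ e
      (λ B r q p bad → h (x ∷ B) r q (ptrans (prep x p) (shift₂ x r q B)) (Sum.map₂ (Sum.map₂ there) bad)))

-- States of a run

HasParent : ℕ → List (ℕ × ℕ) → Set
HasParent c acc = Any (λ e → proj₁ e ≡ c) acc

≡ᵇ-true : ∀ x c → (x ≡ᵇ c) ≡ true → x ≡ c
≡ᵇ-true x c e = ≡ᵇ⇒≡ x c (subst T (sym e) tt)

≡ᵇ-false : ∀ x c → (x ≡ᵇ c) ≡ false → x ≢ c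
≡ᵇ-false x c e x≡c = subst T e (≡⇒≡ᵇ x c x≡c)

parentOf-∈ : ∀ c acc → HasParent c acc → (c , parentOf c acc) ∈ acc
parentOf-∈ c ((x , p) ∷ es) d with x ≡ᵇ c in eq
parentOf-∈ c ((x , p) ∷ es) d | true with ≡ᵇ-true x c eq
... | refl = here refl
parentOf-∈ c ((x , p) ∷ es) (here px) | false = ⊥-elim (≡ᵇ-false x c eq px)
parentOf-∈ c ((x , p) ∷ es) (there d) | false = there (parentOf-∈ c es d)

parentOf-++ˡ : ∀ c xs ys → HasParent c xs → parentOf c (xs ++ ys) ≡ parentOf c xs
parentOf-++ˡ c ((x , p) ∷ es) ys d with x ≡ᵇ c in eq
... | true = refl
parentOf-++ˡ c ((x , p) ∷ es) ys (here px) | false = ⊥-elim (≡ᵇ-false x c eq px)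
parentOf-++ˡ c ((x , p) ∷ es) ys (there d) | false = parentOf-++ˡ c es ys d

parentOf-++ʳ : ∀ c xs ys → ¬ HasParent c xs → parentOf c (xs ++ ys) ≡ parentOf c ys
parentOf-++ʳ c [] ys nd = refl
parentOf-++ʳ c ((x , p) ∷ es) ys nd with x ≡ᵇ c in eq
... | true = ⊥-elim (nd (here (≡ᵇ-true x c eq)))
... | false = parentOf-++ʳ c es ys (λ d → nd (there d))

edgesTo : ℕ → List ℕ → List (ℕ × ℕ)
edgesTo lab C = map (λ c → c , lab) C

parentOf-edgesTo : ∀ c lab C → c ∈ C → parentOf c (edgesTo lab C) ≡ lab
parentOf-edgesTo c lab (x ∷ C) mem with x ≡ᵇ c in eq
... | true = refl
parentOf-edgesTo c lab (x ∷ C) (here px) | false = ⊥-elim (≡ᵇ-false x c eq (sym px))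
parentOf-edgesTo c lab (x ∷ C) (there mem) | false = parentOf-edgesTo c lab C mem

HasParent-edgesTo⁻ : ∀ c lab C → HasParent c (edgesTo lab C) → c ∈ C
HasParent-edgesTo⁻ c lab (x ∷ C) (here px) = here (sym px)
HasParent-edgesTo⁻ c lab (x ∷ C) (there d) = there (HasParent-edgesTo⁻ c lab C d)

HasParent-edgesTo⁺ : ∀ c lab C → c ∈ C → HasParent c (edgesTo lab C)
HasParent-edgesTo⁺ c lab (x ∷ C) (here px) = here (sym px)
HasParent-edgesTo⁺ c lab (x ∷ C) (there d) = there (HasParent-edgesTo⁺ c lab C d)

∈-edgesTo⁻ : ∀ {c p} lab C → (c , p) ∈ edgesTo lab C → c ∈ C × p ≡ lab
∈-edgesTo⁻ lab (x ∷ C) (here refl) = here refl , refl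
∈-edgesTo⁻ lab (x ∷ C) (there d) with ∈-edgesTo⁻ lab C d
... | a , b = there a , b

-- ℓ′ + 2 = ℓ + |C| says that the merger consumed two lineages, ℓ − ℓ′ of them leaves and C the nodes.
merge-lineages : ∀ {lab ℓ ℓ′ S} (C B : List ℕ) → ℓ + length S ≡ suc lab → S ↭ C ++ B → ℓ′ + 2 ≡ ℓ + length C →
                 ℓ′ + length (B ++ [ lab ]) ≡ lab
merge-lineages {lab} {ℓ} {ℓ′} {S} C B lineages perm eℓ = +-cancelʳ-≡ 1 _ _ (+-cancelʳ-≡ (length C) _ _ (begin
  ℓ′ + length (B ++ [ lab ]) + 1 + length C ≡⟨ cong (λ k → ℓ′ + k + 1 + length C) (length-++ B) ⟩
  ℓ′ + (length B + 1) + 1 + length C        ≡⟨ regroup ℓ′ (length B) (length C) ⟩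
  (ℓ′ + 2) + (length C + length B)          ≡⟨ cong₂ _+_ eℓ (sym (length-++ C)) ⟩
  ℓ + length C + length (C ++ B)            ≡⟨ cong (ℓ + length C +_) (sym (↭-length perm)) ⟩
  ℓ + length C + length S                   ≡⟨ xy∙z≈xz∙y ℓ (length C) (length S) ⟩
  ℓ + length S + length C                   ≡⟨ cong (_+ length C) (trans lineages (+-comm 1 lab)) ⟩
  lab + 1 + length C                        ∎))
  where
  open ≡-Reasoning
  regroup : ∀ a b c → a + (b + 1) + 1 + c ≡ (a + 2) + (c + b)
  regroup = solve-∀

module States (m : ℕ) where

  n : ℕ
  n = suc (suc m)

  -- A state of a run with k lineages: the internal nodes labelled k, …, n − 1 have been created;
  -- S lists those still present as lineages, acc records the (child , parent) edges of the others.
  record WellFormed (k ℓ : ℕ) (S : List ℕ) (acc : List (ℕ × ℕ)) : Set where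
    field
      lineages         : ℓ + length S ≡ k
      k≤n              : k ≤ n
      nodes-bounded    : ∀ {c} → c ∈ S → k ≤ c × c < n
      edges-bounded    : ∀ {c p} → (c , p) ∈ acc → (k ≤ c × c < n) × (k ≤ p × 1 ≤ p × p < c)
      nodes-unparented : ∀ {c} → c ∈ S → ¬ HasParent c acc
      labels-covered   : ∀ c → k ≤ c → c < n → c ∈ S ⊎ HasParent c acc
      newest           : (S ≡ [] × ℓ ≡ n) ⊎ k ∈ S
      nodes-unique     : Unique S

  open WellFormed public

  WellFormed-initial : WellFormed n n [] []
  WellFormed-initial = record
    { lineages         = +-identityʳ n
    ; k≤n              = ≤-refl
    ; nodes-bounded    = λ ()
    ; edges-bounded    = λ ()
    ; nodes-unparented = λ ()
    ; labels-covered   = λ c n≤c c<n → ⊥-elim (<-irrefl refl (≤-trans c<n n≤c))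
    ; newest           = inj₁ (refl , refl)
    ; nodes-unique     = []
    }

  WellFormed-final : ∀ {ℓ S acc} → WellFormed 1 ℓ S acc → ℓ ≡ 0 × S ≡ 1 ∷ []
  WellFormed-final {ℓ} {S} st with newest st | lineages st
  ... | inj₁ (refl , refl) | ()
  ... | inj₂ 1∈S | e with S | 1∈S
  ... | _ ∷ []     | here refl = +-cancelʳ-≡ 1 ℓ 0 e , refl
  ... | x ∷ y ∷ S′ | _         = ⊥-elim (1+n≰n (subst (2 ≤_) e (≤-trans (s≤s (s≤s z≤n)) (m≤n+m (length (x ∷ y ∷ S′)) ℓ))))

  WellFormed-merge : ∀ {lab ℓ ℓ′ S acc} (C B : List ℕ) → WellFormed (suc lab) ℓ S acc → 1 ≤ lab → S ↭ C ++ B →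
                     ℓ′ + 2 ≡ ℓ + length C → WellFormed lab ℓ′ (B ++ [ lab ]) (acc ++ edgesTo lab C)
  WellFormed-merge {lab} {ℓ} {ℓ′} {S} {acc} C B st lab≥1 perm eℓ = record
    { lineages         = merge-lineages C B (lineages st) perm eℓ
    ; k≤n              = ≤-trans (n≤1+n lab) (k≤n st)
    ; nodes-bounded    = nodes-bounded′
    ; edges-bounded    = edges-bounded′
    ; nodes-unparented = nodes-unparented′
    ; labels-covered   = labels-covered′
    ; newest           = inj₂ (∈-++⁺ʳ B (here refl))
    ; nodes-unique     = Unique-∷ʳ (Unique-++⁻ʳ C uCB) (λ lab∈B → lab∉S (inSB lab∈B))
    }
    where
    inSC : ∀ {c} → c ∈ C → c ∈ S
    inSC c∈C = ∈-resp-↭ (↭-sym perm) (∈-++⁺ˡ c∈C)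
    inSB : ∀ {c} → c ∈ B → c ∈ S
    inSB c∈B = ∈-resp-↭ (↭-sym perm) (∈-++⁺ʳ C c∈B)
    uCB : Unique (C ++ B)
    uCB = Unique-resp-↭ perm (nodes-unique st)
    lab∉S : lab ∉ S
    lab∉S lab∈S = <-irrefl refl (proj₁ (nodes-bounded st lab∈S))
    nodes-bounded′ : ∀ {c} → c ∈ B ++ [ lab ] → lab ≤ c × c < n
    nodes-bounded′ c∈ with ∈-++⁻ B c∈
    ... | inj₁ c∈B = let (a , b) = nodes-bounded st (inSB c∈B) in ≤-trans (n≤1+n lab) a , b
    ... | inj₂ (here refl) = ≤-refl , k≤n st
    edges-bounded′ : ∀ {c p} → (c , p) ∈ acc ++ edgesTo lab C → (lab ≤ c × c < n) × (lab ≤ p × 1 ≤ p × p < c)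
    edges-bounded′ e∈ with ∈-++⁻ acc e∈
    ... | inj₁ e∈acc = let ((a , b) , (c , d , e)) = edges-bounded st e∈acc in (≤-trans (n≤1+n lab) a , b) , (≤-trans (n≤1+n lab) c , d , e)
    ... | inj₂ e∈new with ∈-edgesTo⁻ lab C e∈new
    ...   | c∈C , refl = let (a , b) = nodes-bounded st (inSC c∈C) in (≤-trans (n≤1+n lab) a , b) , (≤-refl , lab≥1 , a)
    nodes-unparented′ : ∀ {c} → c ∈ B ++ [ lab ] → ¬ HasParent c (acc ++ edgesTo lab C)
    nodes-unparented′ {c} c∈ d with ++⁻ acc d | ∈-++⁻ B c∈
    ... | inj₁ d-acc | inj₁ c∈B        = nodes-unparented st (inSB c∈B) d-acc
    ... | inj₁ d-acc | inj₂ (here refl) = <-irrefl refl (proj₁ (proj₁ (edges-bounded st (parentOf-∈ c acc d-acc))))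
    ... | inj₂ d-new | inj₁ c∈B        = Unique-++-disjoint C uCB (HasParent-edgesTo⁻ c lab C d-new) c∈B
    ... | inj₂ d-new | inj₂ (here refl) = lab∉S (inSC (HasParent-edgesTo⁻ c lab C d-new))
    labels-covered′ : ∀ c → lab ≤ c → c < n → c ∈ B ++ [ lab ] ⊎ HasParent c (acc ++ edgesTo lab C)
    labels-covered′ c lab≤c c<n with m≤n⇒m<n∨m≡n lab≤c
    ... | inj₂ refl = inj₁ (∈-++⁺ʳ B (here refl))
    ... | inj₁ lab<c with labels-covered st c lab<c c<n
    ...   | inj₂ d = inj₂ (++⁺ˡ d)
    ...   | inj₁ c∈S with ∈-++⁻ C (∈-resp-↭ perm c∈S)
    ...     | inj₁ c∈C = inj₂ (++⁺ʳ acc (HasParent-edgesTo⁺ c lab C c∈C))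
    ...     | inj₂ c∈B = inj₁ (∈-++⁺ˡ c∈B)

  WellFormed-leafPair : ∀ {lab ℓ S acc} → WellFormed (suc lab) ℓ S acc → 1 ≤ lab → 2 ≤ ℓ →
                        WellFormed lab (ℓ ∸ 2) (S ++ [ lab ]) acc
  WellFormed-leafPair {lab} {ℓ} {S} {acc} st lab≥1 ℓ≥2 =
    subst (WellFormed lab (ℓ ∸ 2) (S ++ [ lab ])) (++-identityʳ acc)
          (WellFormed-merge [] S st lab≥1 prefl (trans (m∸n+n≡m ℓ≥2) (sym (+-identityʳ ℓ))))

  WellFormed-leafNode : ∀ {lab ℓ S acc s B} → WellFormed (suc lab) ℓ S acc → 1 ≤ lab → S ↭ s ∷ B → 1 ≤ ℓ →
                        WellFormed lab (pred ℓ) (B ++ [ lab ]) (acc ++ [ (s , lab) ])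
  WellFormed-leafNode {s = s} {B} st lab≥1 perm ℓ≥1 = WellFormed-merge (s ∷ []) B st lab≥1 perm (pred+2 ℓ≥1)

  WellFormed-nodePair : ∀ {lab ℓ S acc r q B} → WellFormed (suc lab) ℓ S acc → 1 ≤ lab → S ↭ r ∷ q ∷ B →
                        WellFormed lab ℓ (B ++ [ lab ]) (acc ++ (r , lab) ∷ (q , lab) ∷ [])
  WellFormed-nodePair {r = r} {q} {B} st lab≥1 perm = WellFormed-merge (r ∷ q ∷ []) B st lab≥1 perm refl

  module _ {Q : Pred (List (ℕ × ℕ)) 0ℓ} (Q? : Decidable Q) where
    open RunCount Q?

    countFrom-suc-wf : ∀ {f ℓ S acc} → WellFormed (suc (suc f)) ℓ S acc → countFrom (suc f) ℓ S acc ≡ mergeExpansion f ℓ S acc (suc f)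
    countFrom-suc-wf {f} {ℓ} {S} {acc} st = trans (countFrom-suc f ℓ S acc) (cong (λ k → mergeExpansion f ℓ S acc (k ∸ 1)) (lineages st))

    countFrom-vanishing : (I : ℕ → List ℕ → List (ℕ × ℕ) → Set) →
      (∀ {lab ℓ ℓ′ S acc} C B → WellFormed (suc lab) ℓ S acc → 1 ≤ lab → S ↭ C ++ B → ℓ′ + 2 ≡ ℓ + length C →
         I (suc lab) S acc → I lab (B ++ [ lab ]) (acc ++ edgesTo lab C)) →
      (∀ {ℓ S acc} → WellFormed 1 ℓ S acc → I 1 S acc → ¬ Q acc) →
      ∀ f {ℓ S acc} → WellFormed (suc f) ℓ S acc → I (suc f) S acc → countFrom f ℓ S acc ≡ 0
    countFrom-vanishing I preserved excludes zero {ℓ} {S} st i = countFrom-zero-no ℓ S (excludes st i)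
    countFrom-vanishing I preserved excludes (suc f) {ℓ} {S} {acc} st i =
      trans (countFrom-suc-wf st) (cong₂ _+_ (cong₂ _+_ leafPair leafNode) nodePair)
      where
      lab≥1 : 1 ≤ suc f
      lab≥1 = s≤s z≤n
      leafPair : choose₂ ℓ * countFrom f (ℓ ∸ 2) (S ++ [ suc f ]) acc ≡ 0
      leafPair = choose₂*-vanishing ℓ λ ℓ≥2 → countFrom-vanishing I preserved excludes f (WellFormed-leafPair st lab≥1 ℓ≥2)
        (subst (I (suc f) (S ++ [ suc f ])) (++-identityʳ acc) (preserved [] S st lab≥1 prefl (trans (m∸n+n≡m ℓ≥2) (sym (+-identityʳ ℓ))) i))
      leafNode : ℓ * sumSelect₁ (λ B s → countFrom f (pred ℓ) (B ++ [ suc f ]) (acc ++ [ (s , suc f) ])) S ≡ 0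
      leafNode = *-vanishing ℓ λ ℓ≥1 → sumSelect₁-vanishing _ S λ B s perm →
        countFrom-vanishing I preserved excludes f (WellFormed-leafNode st lab≥1 perm ℓ≥1) (preserved (s ∷ []) B st lab≥1 perm (pred+2 ℓ≥1) i)
      nodePair : sumSelect₂ (λ B r q → countFrom f ℓ (B ++ [ suc f ]) (acc ++ (r , suc f) ∷ (q , suc f) ∷ [])) S ≡ 0
      nodePair = sumSelect₂-vanishing _ S λ B r q perm →
        countFrom-vanishing I preserved excludes f (WellFormed-nodePair st lab≥1 perm) (preserved (r ∷ q ∷ []) B st lab≥1 perm refl i)

_‼_ : List ℕ → ℕ → ℕ
[]       ‼ i     = 0
(x ∷ xs) ‼ zero  = x
(x ∷ xs) ‼ suc i = xs ‼ i

‼-++ˡ : ∀ xs ys i → i < length xs → (xs ++ ys) ‼ i ≡ xs ‼ i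
‼-++ˡ (x ∷ xs) ys zero    _       = refl
‼-++ˡ (x ∷ xs) ys (suc i) (s≤s i<) = ‼-++ˡ xs ys i i<

‼-++-length : ∀ xs y → (xs ++ [ y ]) ‼ length xs ≡ y
‼-++-length []       y = refl
‼-++-length (x ∷ xs) y = ‼-++-length xs y

‼-beyond : ∀ xs i → length xs ≤ i → xs ‼ i ≡ 0
‼-beyond []       i       _        = refl
‼-beyond (x ∷ xs) (suc i) (s≤s ≤i) = ‼-beyond xs i ≤i

map-‼-upTo : ∀ xs → map (xs ‼_) (upTo (length xs)) ≡ xs
map-‼-upTo []       = refl
map-‼-upTo (x ∷ xs) =
  cong (x ∷_) (trans (map-applyUpTo suc ((x ∷ xs) ‼_) (length xs)) (trans (sym (map-upTo (xs ‼_) (length xs))) (map-‼-upTo xs)))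

∈-range⁻ : ∀ {x} a b → x ∈ range a b → a ≤ x × x ≤ b
∈-range⁻ {x} a b x∈ with ∈-map⁻ (_+ a) x∈
... | i , i∈ , refl = m≤n+m a i , bounded (∈-upTo⁻ i∈)
  where
  bounded : i < suc b ∸ a → i + a ≤ b
  bounded i< with a ≤? suc b
  ... | yes a≤ = ≤-pred (begin-strict
      i + a           <⟨ +-monoˡ-< a i< ⟩
      (suc b ∸ a) + a ≡⟨ m∸n+n≡m a≤ ⟩
      suc b           ∎)
    where open ≤-Reasoning
  ... | no a≰ = ⊥-elim (n≮0 (subst (i <_) (m≤n⇒m∸n≡0 (<⇒≤ (≰⇒> a≰))) i<))

∈-range⁺ : ∀ {x} a b → a ≤ x → x ≤ b → x ∈ range a b
∈-range⁺ {x} a b a≤x x≤b = subst (_∈ range a b) (m∸n+n≡m a≤x) (∈-map⁺ (_+ a) (∈-upTo⁺ x∸a<))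
  where
  x∸a< : x ∸ a < suc b ∸ a
  x∸a< = subst (x ∸ a <_) (sym (+-∸-assoc 1 (≤-trans a≤x x≤b))) (s≤s (∸-monoˡ-≤ a x≤b))

range-∷ʳ : ∀ {a} b → a ≤ suc b → range a (suc b) ≡ range a b ++ [ suc b ]
range-∷ʳ {a} b a≤ = begin
  map (_+ a) (upTo (suc (suc b) ∸ a))            ≡⟨ cong (λ k → map (_+ a) (upTo k)) (+-∸-assoc 1 a≤) ⟩
  map (_+ a) (upTo (suc (suc b ∸ a)))            ≡⟨ cong (map (_+ a)) (sym (upTo-∷ʳ (suc b ∸ a))) ⟩
  map (_+ a) (upTo (suc b ∸ a) ++ [ suc b ∸ a ]) ≡⟨ map-++ (_+ a) (upTo (suc b ∸ a)) _ ⟩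
  range a b ++ [ suc b ∸ a + a ]                 ≡⟨ cong (λ k → range a b ++ [ k ]) (m∸n+n≡m a≤) ⟩
  range a b ++ [ suc b ]                         ∎
  where open ≡-Reasoning

Unique-range : ∀ a b → Unique (range a b)
Unique-range a b = subst Unique (sym (map-upTo (_+ a) (suc b ∸ a)))
  (UP.applyUpTo⁺₁ (_+ a) (suc b ∸ a) (λ i<j _ e → <-irrefl (+-cancelʳ-≡ a _ _ e) i<j))

candidates-length : ∀ m xs → xs ∈ candidates m → length xs ≡ m
candidates-length zero    .[] (here refl) = refl
candidates-length (suc m) xs  xs∈ with find (∈-concatMap⁻ (λ ps → map (λ p → ps ++ [ p ]) (range 1 (suc m))) {xs = candidates m} xs∈)
... | ps , ps∈ , xs∈′ with ∈-map⁻ (λ p → ps ++ [ p ]) xs∈′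
... | p , _ , refl = trans (length-++ ps) (trans (+-comm (length ps) 1) (cong suc (candidates-length m ps ps∈)))

candidates-bounds : ∀ m xs → xs ∈ candidates m → ∀ i → i < m → 1 ≤ xs ‼ i × xs ‼ i ≤ suc i
candidates-bounds (suc m) xs xs∈ i i<m with find (∈-concatMap⁻ (λ ps → map (λ p → ps ++ [ p ]) (range 1 (suc m))) {xs = candidates m} xs∈)
... | ps , ps∈ , xs∈′ with ∈-map⁻ (λ p → ps ++ [ p ]) xs∈′
... | p , p∈ , refl with m≤n⇒m<n∨m≡n (≤-pred i<m)
...   | inj₁ i<m′ = subst (λ x → 1 ≤ x × x ≤ suc i) (sym (‼-++ˡ ps [ p ] i (subst (i <_) (sym (candidates-length m ps ps∈)) i<m′)))
                          (candidates-bounds m ps ps∈ i i<m′)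
...   | inj₂ refl = subst (λ x → 1 ≤ x × x ≤ suc i) (sym (subst (λ j → (ps ++ [ p ]) ‼ j ≡ p) (candidates-length m ps ps∈) (‼-++-length ps p)))
                          (∈-range⁻ 1 (suc i) p∈)

∈-candidates : ∀ m (h : ℕ → ℕ) → (∀ c → 2 ≤ c → c ≤ suc m → 1 ≤ h c × h c < c) → map h (range 2 (suc m)) ∈ candidates m
∈-candidates zero h hb = here refl
∈-candidates (suc m) h bounds = subst (_∈ candidates (suc m)) (sym snoc)
    (∈-concatMap⁺ (λ ps → map (λ p → ps ++ [ p ]) (range 1 (suc m))) {xs = candidates m}
       (Any.map (λ { refl → ∈-map⁺ (λ p → map h (range 2 (suc m)) ++ [ p ]) h∈ }) (∈-candidates m h bounds′)))
  where
  snoc : map h (range 2 (suc (suc m))) ≡ map h (range 2 (suc m)) ++ [ h (suc (suc m)) ]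
  snoc = trans (cong (map h) (range-∷ʳ (suc m) (s≤s (s≤s z≤n)))) (map-++ h (range 2 (suc m)) _)
  bounds′ : ∀ c → 2 ≤ c → c ≤ suc m → 1 ≤ h c × h c < c
  bounds′ c 2≤c c≤ = bounds c 2≤c (≤-trans c≤ (n≤1+n _))
  h∈ : h (suc (suc m)) ∈ range 1 (suc m)
  h∈ = let (h≥1 , h<) = bounds (suc (suc m)) (s≤s (s≤s z≤n)) ≤-refl in ∈-range⁺ 1 (suc m) h≥1 (≤-pred h<)

module Outcomes (m : ℕ) where
  open States m

  nonCandidate? : (acc : List (ℕ × ℕ)) → Dec (treeOf n acc ∉ candidates m)
  nonCandidate? acc = ¬? (treeOf n acc ∈? candidates m)

  open RunCount nonCandidate?

  final-candidate : ∀ {ℓ S acc} → WellFormed 1 ℓ S acc → treeOf n acc ∈ candidates m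
  final-candidate st with WellFormed-final st
  final-candidate {acc = acc} st | refl , refl = ∈-candidates m (λ c → parentOf c acc) parentBounds
    where
    parentBounds : ∀ c → 2 ≤ c → c ≤ suc m → 1 ≤ parentOf c acc × parentOf c acc < c
    parentBounds c 2≤c c≤ with labels-covered st c (≤-trans (s≤s z≤n) 2≤c) (s≤s c≤)
    ... | inj₁ (here refl) = ⊥-elim (<-irrefl refl 2≤c)
    ... | inj₂ d           = let (_ , (_ , p≥1 , p<c)) = edges-bounded st (parentOf-∈ c acc d) in p≥1 , p<c

  count-nonCandidates : ∀ f {ℓ S acc} → WellFormed (suc f) ℓ S acc → countFrom f ℓ S acc ≡ 0
  count-nonCandidates f st = countFrom-vanishing nonCandidate? (λ _ _ _ → ⊤) (λ _ _ _ _ _ _ _ → tt)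
    (λ st _ ∉ → ∉ (final-candidate st)) f st tt

-- Runs producing a given tree

length-filter-map : (f : A → ℕ) (v : ℕ) (xs : List A) →
  length (filter (λ y → v ≟ y) (map f xs)) ≡ length (filter (λ x → v ≟ f x) xs)
length-filter-map f v []       = refl
length-filter-map f v (x ∷ xs) with v ≡ᵇ f x
... | true  = cong suc (length-filter-map f v xs)
... | false = length-filter-map f v xs

module Target (m : ℕ) (ps : List ℕ) (ps∈ : ps ∈ candidates m) where
  open States m

  length-ps : length ps ≡ m
  length-ps = candidates-length m ps ps∈

  -- The parent of c in the target tree; the root 1 and the junk label 0 get 0.
  par : ℕ → ℕ
  par zero          = 0
  par (suc zero)    = 0
  par (suc (suc j)) = ps ‼ j

  par< : ∀ c → 1 ≤ c → par c < c
  par< (suc zero)    _ = s≤s z≤n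
  par< (suc (suc j)) _ with j <? m
  ... | yes j<m = s≤s (proj₂ (candidates-bounds m ps ps∈ j j<m))
  ... | no  j≮m = subst (_< suc (suc j)) (sym (‼-beyond ps j (subst (_≤ j) (sym length-ps) (≮⇒≥ j≮m)))) (s≤s z≤n)

  par-positive : ∀ c → 1 ≤ par c → 2 ≤ c × c < n
  par-positive (suc (suc j)) par≥1 with j <? m
  ... | yes j<m = s≤s (s≤s z≤n) , s≤s (s≤s j<m)
  ... | no  j≮m = ⊥-elim (<-irrefl refl (subst (1 ≤_) (‼-beyond ps j (subst (_≤ j) (sym length-ps) (≮⇒≥ j≮m))) par≥1))

  par≥1 : ∀ c → 2 ≤ c → c < n → 1 ≤ par c
  par≥1 (suc zero)    (s≤s ()) _
  par≥1 (suc (suc j)) _        (s≤s (s≤s j<m)) = proj₁ (candidates-bounds m ps ps∈ j j<m)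

  nonRootLabels : List ℕ
  nonRootLabels = range 2 (suc m)

  ps≡map-par : ps ≡ map par nonRootLabels
  ps≡map-par = sym (begin
    map par (map (_+ 2) (upTo m))     ≡⟨ ListProp.map-∘ (upTo m) ⟨
    map (λ i → par (i + 2)) (upTo m)  ≡⟨ map-cong (λ i → cong par (+-comm i 2)) (upTo m) ⟩
    map (ps ‼_) (upTo m)              ≡⟨ cong (λ k → map (ps ‼_) (upTo k)) (sym length-ps) ⟩
    map (ps ‼_) (upTo (length ps))    ≡⟨ map-‼-upTo ps ⟩
    ps                                ∎)
    where open ≡-Reasoning

  -- Agreement of a state with the target tree, and its negation in positive form.
  Agrees : ℕ → List ℕ → List (ℕ × ℕ) → Set
  Agrees k S acc = (∀ {c} → HasParent c acc → parentOf c acc ≡ par c) × (∀ {c} → c ∈ S → par c < k)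

  Disagrees : ℕ → List ℕ → List (ℕ × ℕ) → Set
  Disagrees k S acc = (Σ ℕ λ c → HasParent c acc × parentOf c acc ≢ par c) ⊎ (Σ ℕ λ c → c ∈ S × k ≤ par c)

  module Merging (lab : ℕ) (lab≥1 : 1 ≤ lab) where

    IsChild : ℕ → Set
    IsChild c = lab ≡ par c

    isChild? : (c : ℕ) → Dec (IsChild c)
    isChild? c = lab ≟ par c

    open Partition isChild? public

    parentOf-merged : ∀ {ℓ S acc} C B → WellFormed (suc lab) ℓ S acc → S ↭ C ++ B → ∀ {c} → c ∈ C → parentOf c (acc ++ edgesTo lab C) ≡ lab
    parentOf-merged {acc = acc} C B st perm {c} c∈C =
      trans (parentOf-++ʳ c acc _ (nodes-unparented st (∈-resp-↭ (↭-sym perm) (∈-++⁺ˡ c∈C)))) (parentOf-edgesTo c lab C c∈C)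

    Disagrees-merge : ∀ {ℓ S acc} C B → WellFormed (suc lab) ℓ S acc → S ↭ C ++ B →
      (Disagrees (suc lab) S acc ⊎ Any (λ c → ¬ IsChild c) C ⊎ Any IsChild B) → Disagrees lab (B ++ [ lab ]) (acc ++ edgesTo lab C)
    Disagrees-merge {acc = acc} C B st perm (inj₁ (inj₁ (c , d , ≢par))) = inj₁ (c , ++⁺ˡ d , λ e → ≢par (trans (sym (parentOf-++ˡ c acc _ d)) e))
    Disagrees-merge {acc = acc} C B st perm (inj₁ (inj₂ (c , c∈S , lab<par))) with ∈-++⁻ C (∈-resp-↭ perm c∈S)
    ... | inj₁ c∈C = inj₁ (c , ++⁺ʳ acc (HasParent-edgesTo⁺ c lab C c∈C) ,
                           λ e → <-irrefl refl (≤-trans lab<par (≤-reflexive (trans (sym e) (parentOf-merged C B st perm c∈C)))))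
    ... | inj₂ c∈B = inj₂ (c , ∈-++⁺ˡ c∈B , ≤-trans (n≤1+n lab) lab<par)
    Disagrees-merge {acc = acc} C B st perm (inj₂ (inj₁ wrongMerged)) with find wrongMerged
    ... | c , c∈C , ¬child = inj₁ (c , ++⁺ʳ acc (HasParent-edgesTo⁺ c lab C c∈C) , λ e → ¬child (trans (sym (parentOf-merged C B st perm c∈C)) e))
    Disagrees-merge {acc = acc} C B st perm (inj₂ (inj₂ childLeft)) with find childLeft
    ... | c , c∈B , child = inj₂ (c , ∈-++⁺ˡ c∈B , ≤-reflexive child)

    Agrees-merge : ∀ {ℓ S acc} C B → WellFormed (suc lab) ℓ S acc → S ↭ C ++ B → Agrees (suc lab) S acc →
      All IsChild C → All (λ c → ¬ IsChild c) B → Agrees lab (B ++ [ lab ]) (acc ++ edgesTo lab C)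
    Agrees-merge {acc = acc} C B st perm (recorded , pending) childrenC othersB = recorded′ , pending′
      where
      recorded′ : ∀ {c} → HasParent c (acc ++ edgesTo lab C) → parentOf c (acc ++ edgesTo lab C) ≡ par c
      recorded′ {c} d with ++⁻ acc d
      ... | inj₁ d-acc = trans (parentOf-++ˡ c acc _ d-acc) (recorded d-acc)
      ... | inj₂ d-new = let c∈C = HasParent-edgesTo⁻ c lab C d-new in trans (parentOf-merged C B st perm c∈C) (All.lookup childrenC c∈C)
      pending′ : ∀ {c} → c ∈ B ++ [ lab ] → par c < lab
      pending′ {c} c∈ with ∈-++⁻ B c∈
      ... | inj₂ (here refl) = par< lab lab≥1
      ... | inj₁ c∈B = ≤∧≢⇒< (≤-pred (pending (∈-resp-↭ (↭-sym perm) (∈-++⁺ʳ C c∈B)))) (λ e → All.lookup othersB c∈B (sym e))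

    length-hits≡childCount : ∀ {ℓ S acc} → WellFormed (suc lab) ℓ S acc → Agrees (suc lab) S acc → length (hits S) ≡ countℕ lab ps
    length-hits≡childCount {ℓ} {S} {acc} st (recorded , pending) =
      trans sameLength (sym (trans (cong (countℕ lab) ps≡map-par) (length-filter-map par lab nonRootLabels)))
      where
      to : ∀ {x} → x ∈ hits S → x ∈ hits nonRootLabels
      to x∈ with ∈-filter⁻ isChild? {xs = S} x∈
      ... | _ , child = ∈-filter⁺ isChild? (∈-range⁺ 2 (suc m) (proj₁ bounds) (≤-pred (proj₂ bounds))) child
        where bounds = par-positive _ (subst (1 ≤_) child lab≥1)
      from : ∀ {x} → x ∈ hits nonRootLabels → x ∈ hits S
      from {x} x∈ with ∈-filter⁻ isChild? {xs = nonRootLabels} x∈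
      ... | x∈R , child with ∈-range⁻ 2 (suc m) x∈R
      ... | 2≤x , x≤ with labels-covered st x (subst (_< x) (sym child) (par< x (≤-trans (s≤s z≤n) 2≤x))) (s≤s x≤)
      ...   | inj₁ x∈S = ∈-filter⁺ isChild? x∈S child
      ...   | inj₂ d   = ⊥-elim (<-irrefl refl (≤-trans (proj₁ (proj₂ (edges-bounded st (parentOf-∈ x acc d)))) (≤-reflexive (trans (recorded d) (sym child)))))
      sameLength : length (hits S) ≡ length (hits nonRootLabels)
      sameLength = ↭-length (∼bag⇒↭ (unique∧set⇒bag (UP.filter⁺ isChild? (nodes-unique st)) (UP.filter⁺ isChild? (Unique-range 2 (suc m))) (mk⇔ to from)))

leafPair-leaves : ∀ ℓ M f → ℓ + (0 + M) ≡ 2 * suc f → M ≤ 2 * f → 2 ≤ ℓ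
leafPair-leaves zero          M f e M≤ = ⊥-elim (1+n≰n (≤-trans (n≤1+n _) (subst (_≤ 2 * f) (trans e (2*suc f)) M≤)))
leafPair-leaves (suc zero)    M f e M≤ = ⊥-elim (1+n≰n (subst (_≤ 2 * f) (suc-injective (trans e (2*suc f))) M≤))
leafPair-leaves (suc (suc l)) M f e _  = s≤s (s≤s z≤n)

leafPair-budget : ∀ ℓ M f → ℓ + (0 + M) ≡ 2 * suc f → 2 ≤ ℓ → ℓ ∸ 2 + M ≡ 2 * f
leafPair-budget (suc zero)    M f e (s≤s ())
leafPair-budget (suc (suc l)) M f e _ = suc-injective (suc-injective (trans e (2*suc f)))

leafNode-leaves : ∀ ℓ M f → ℓ + (1 + M) ≡ 2 * suc f → M ≤ 2 * f → 1 ≤ ℓ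
leafNode-leaves zero    M f e M≤ = ⊥-elim (1+n≰n (subst (_≤ 2 * f) (suc-injective (trans e (2*suc f))) M≤))
leafNode-leaves (suc l) M f e _  = s≤s z≤n

leafNode-budget : ∀ ℓ M f → ℓ + (1 + M) ≡ 2 * suc f → 1 ≤ ℓ → pred ℓ + M ≡ 2 * f
leafNode-budget (suc l) M f e _ = suc-injective (trans (sym (+-suc l M)) (suc-injective (trans e (2*suc f))))

nodePair-budget : ∀ ℓ M f → ℓ + (2 + M) ≡ 2 * suc f → ℓ + M ≡ 2 * f
nodePair-budget ℓ M f e = suc-injective (suc-injective (trans (regroup ℓ M) (trans e (2*suc f))))
  where
  regroup : ∀ l M → suc (suc (l + M)) ≡ l + (2 + M)
  regroup = solve-∀

countBelow : List ℕ → ℕ → ℕ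
countBelow xs zero    = 0
countBelow xs (suc K) = countℕ K xs + countBelow xs K

indicatorBelow : ℕ → ℕ → ℕ
indicatorBelow zero    x = 0
indicatorBelow (suc K) x = (if K ≡ᵇ x then 1 else 0) + indicatorBelow K x

countℕ-∷ : ∀ j x xs → countℕ j (x ∷ xs) ≡ (if j ≡ᵇ x then 1 else 0) + countℕ j xs
countℕ-∷ j x xs with j ≡ᵇ x
... | true  = refl
... | false = refl

countBelow-∷ : ∀ x xs K → countBelow (x ∷ xs) K ≡ indicatorBelow K x + countBelow xs K
countBelow-∷ x xs zero    = refl
countBelow-∷ x xs (suc K) = begin
  countℕ K (x ∷ xs) + countBelow (x ∷ xs) K
    ≡⟨ cong₂ _+_ (countℕ-∷ K x xs) (countBelow-∷ x xs K) ⟩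
  (if K ≡ᵇ x then 1 else 0) + countℕ K xs + (indicatorBelow K x + countBelow xs K)
    ≡⟨ interchange (if K ≡ᵇ x then 1 else 0) (countℕ K xs) (indicatorBelow K x) (countBelow xs K) ⟩
  indicatorBelow (suc K) x + countBelow xs (suc K) ∎
  where open ≡-Reasoning

indicatorBelow-≥ : ∀ K x → K ≤ x → indicatorBelow K x ≡ 0
indicatorBelow-≥ zero    x _   = refl
indicatorBelow-≥ (suc K) x K<x with K ≡ᵇ x in eq
... | true  = ⊥-elim (<-irrefl (≡ᵇ-true K x eq) K<x)
... | false = indicatorBelow-≥ K x (≤-trans (n≤1+n K) K<x)

indicatorBelow-< : ∀ K x → x < K → indicatorBelow K x ≡ 1
indicatorBelow-< (suc K) x x<K with K ≡ᵇ x in eq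
... | true = cong suc (indicatorBelow-≥ K x (≤-reflexive (≡ᵇ-true K x eq)))
... | false with m≤n⇒m<n∨m≡n (≤-pred x<K)
...   | inj₁ x<K′ = indicatorBelow-< K x x<K′
...   | inj₂ refl = ⊥-elim (≡ᵇ-false x x eq refl)

countBelow-[] : ∀ K → countBelow [] K ≡ 0
countBelow-[] zero    = refl
countBelow-[] (suc K) = countBelow-[] K

countBelow-all : ∀ K xs → (∀ {x} → x ∈ xs → x < K) → countBelow xs K ≡ length xs
countBelow-all K []       _ = countBelow-[] K
countBelow-all K (x ∷ xs) h =
  trans (countBelow-∷ x xs K) (cong₂ _+_ (indicatorBelow-< K x (h (here refl))) (countBelow-all K xs (λ x∈ → h (there x∈))))

module Production (m : ℕ) (ps : List ℕ) (ps∈ : ps ∈ candidates m) where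
  open States m
  open Target m ps ps∈

  producesTarget? : (acc : List (ℕ × ℕ)) → Dec (treeOf n acc ≡ ps)
  producesTarget? acc = ≡-dec _≟_ (treeOf n acc) ps

  open RunCount producesTarget?

  childCount : ℕ → ℕ
  childCount c = countℕ c ps

  childrenBelow : ℕ → ℕ
  childrenBelow = countBelow ps

  isZero : ℕ → ℕ
  isZero zero    = 1
  isZero (suc _) = 0

  cherriesBelow : ℕ → ℕ
  cherriesBelow zero          = 0
  cherriesBelow (suc zero)    = 0
  cherriesBelow (suc (suc k)) = isZero (childCount (suc k)) + cherriesBelow (suc k)

  Binary : ℕ → Set
  Binary k = ∀ c → c < k → childCount c ≤ 2

  childCount-0 : childCount 0 ≡ 0
  childCount-0 = trans (cong (countℕ 0) ps≡map-par) (trans (length-filter-map par 0 nonRootLabels)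
    (cong length (filter-none (λ x → 0 ≟ par x) (All.tabulate λ {x} x∈ e →
       let (2≤x , x≤) = ∈-range⁻ 2 (suc m) x∈ in <-irrefl e (par≥1 x 2≤x (s≤s x≤))))))

  childrenBelow-bound : ∀ j → Binary (suc j) → childrenBelow (suc j) ≤ 2 * j
  childrenBelow-bound zero    _   = ≤-reflexive (cong (_+ 0) childCount-0)
  childrenBelow-bound (suc j) bin =
    ≤-trans (+-mono-≤ (bin (suc j) ≤-refl) (childrenBelow-bound j (λ c c< → bin c (≤-trans c< (n≤1+n _)))))
            (≤-reflexive (sym (*-distribˡ-+ 2 1 j)))

  Binary-down : ∀ k → Binary (suc k) → Binary k
  Binary-down k bin c c<k = bin c (≤-trans c<k (n≤1+n _))

  Binary-up : ∀ k → Binary k → childCount k ≤ 2 → Binary (suc k)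
  Binary-up k bin ≤2 c c< with m≤n⇒m<n∨m≡n (≤-pred c<)
  ... | inj₁ c<k  = bin c c<k
  ... | inj₂ refl = ≤2

  Binary-1 : Binary 1
  Binary-1 zero    _ = subst (_≤ 2) (sym childCount-0) z≤n
  Binary-1 (suc c) (s≤s ())

  disagreeing⇒wrongTree : ∀ {ℓ S acc} → WellFormed 1 ℓ S acc → Disagrees 1 S acc → treeOf n acc ≢ ps
  disagreeing⇒wrongTree st dis e with WellFormed-final st
  disagreeing⇒wrongTree st (inj₂ (c , here refl , ())) _ | refl , refl
  disagreeing⇒wrongTree {acc = acc} st (inj₁ (c , d , ≢par)) e | refl , refl =
    ≢par (map-≡⇒pointwise (λ c → parentOf c acc) par nonRootLabels (trans e ps≡map-par) c∈R)
    where
    bounds : 1 ≤ c × c < n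
    bounds = proj₁ (edges-bounded st (parentOf-∈ c acc d))
    c≢1 : c ≢ 1
    c≢1 refl = nodes-unparented st (here refl) d
    c∈R : c ∈ nonRootLabels
    c∈R = ∈-range⁺ 2 (suc m) (≤∧≢⇒< (proj₁ bounds) (λ e → c≢1 (sym e))) (≤-pred (proj₂ bounds))

  agreeing⇒rightTree : ∀ {ℓ S acc} → WellFormed 1 ℓ S acc → Agrees 1 S acc → treeOf n acc ≡ ps
  agreeing⇒rightTree st ag with WellFormed-final st
  agreeing⇒rightTree {acc = acc} st (recorded , _) | refl , refl =
    trans (pointwise⇒map-≡ (λ c → parentOf c acc) par nonRootLabels parentsAgree) (sym ps≡map-par)
    where
    parentsAgree : ∀ {c} → c ∈ nonRootLabels → parentOf c acc ≡ par c
    parentsAgree {c} c∈ with ∈-range⁻ 2 (suc m) c∈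
    ... | 2≤c , c≤ with labels-covered st c (≤-trans (s≤s z≤n) 2≤c) (s≤s c≤)
    ...   | inj₁ (here refl) = ⊥-elim (<-irrefl refl 2≤c)
    ...   | inj₂ d           = recorded d

  count-disagreeing : ∀ f {ℓ S acc} → WellFormed (suc f) ℓ S acc → Disagrees (suc f) S acc → countFrom f ℓ S acc ≡ 0
  count-disagreeing = countFrom-vanishing producesTarget? Disagrees
    (λ {lab} C B st lab≥1 perm _ dis → Merging.Disagrees-merge lab lab≥1 C B st perm (inj₁ dis))
    disagreeing⇒wrongTree

  CountLaw : ℕ → ℕ → List ℕ → List (ℕ × ℕ) → Set
  CountLaw f ℓ S acc = (Binary (suc f) → countFrom f ℓ S acc * 2 ^ cherriesBelow (suc f) ≡ ℓ !)
                     × (¬ Binary (suc f) → countFrom f ℓ S acc ≡ 0)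

  -- The hypothesis on ℓ says that the leaves still present are exactly the leaf children of labels ≤ f.
  AgreeingCount : ℕ → Set
  AgreeingCount f = ∀ {ℓ S acc} → WellFormed (suc f) ℓ S acc → Agrees (suc f) S acc →
                    ℓ + childrenBelow (suc f) ≡ 2 * f → CountLaw f ℓ S acc

  count-agreeing-final : AgreeingCount 0
  count-agreeing-final st ag _ with WellFormed-final st
  ... | refl , refl = (λ _ → trans (*-identityʳ _) (countFrom-zero-yes 0 [ 1 ] (agreeing⇒rightTree st ag))) , (λ ¬bin → ⊥-elim (¬bin Binary-1))

  module Step (f : ℕ) {ℓ S acc} (st : WellFormed (suc (suc f)) ℓ S acc) (ag : Agrees (suc (suc f)) S acc)
              (budget : ℓ + childrenBelow (suc (suc f)) ≡ 2 * suc f) (ih : AgreeingCount f) where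

    lab : ℕ
    lab = suc f

    lab≥1 : 1 ≤ lab
    lab≥1 = s≤s z≤n

    open Merging lab lab≥1

    leafPairCount : ℕ
    leafPairCount = countFrom f (ℓ ∸ 2) (S ++ [ lab ]) acc

    leafNodeCount : List ℕ → ℕ → ℕ
    leafNodeCount B s = countFrom f (pred ℓ) (B ++ [ lab ]) (acc ++ [ (s , lab) ])

    nodePairCount : List ℕ → ℕ → ℕ → ℕ
    nodePairCount B r q = countFrom f ℓ (B ++ [ lab ]) (acc ++ (r , lab) ∷ (q , lab) ∷ [])

    expansion : countFrom (suc f) ℓ S acc ≡ choose₂ ℓ * leafPairCount + ℓ * sumSelect₁ leafNodeCount S + sumSelect₂ nodePairCount S
    expansion = countFrom-suc-wf producesTarget? st

    children : length (hits S) ≡ childCount lab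
    children = length-hits≡childCount st ag

    leafPair-wrong : Any IsChild S → 2 ≤ ℓ → leafPairCount ≡ 0
    leafPair-wrong childLeft ℓ≥2 = count-disagreeing f (WellFormed-leafPair st lab≥1 ℓ≥2)
      (subst (Disagrees lab (S ++ [ lab ])) (++-identityʳ acc) (Disagrees-merge [] S st prefl (inj₂ (inj₂ childLeft))))

    leafNode-wrong : ∀ B s → S ↭ s ∷ B → ¬ IsChild s ⊎ Any IsChild B → 1 ≤ ℓ → leafNodeCount B s ≡ 0
    leafNode-wrong B s perm wrong ℓ≥1 = count-disagreeing f (WellFormed-leafNode st lab≥1 perm ℓ≥1)
      (Disagrees-merge (s ∷ []) B st perm (inj₂ (Sum.map₁ here wrong)))

    nodePair-wrong : ∀ B r q → S ↭ r ∷ q ∷ B → ¬ IsChild r ⊎ ¬ IsChild q ⊎ Any IsChild B → nodePairCount B r q ≡ 0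
    nodePair-wrong B r q perm wrong = count-disagreeing f (WellFormed-nodePair st lab≥1 perm)
      (Disagrees-merge (r ∷ q ∷ []) B st perm (inj₂ (reshape wrong)))
      where
      reshape : ¬ IsChild r ⊎ ¬ IsChild q ⊎ Any IsChild B → Any (λ c → ¬ IsChild c) (r ∷ q ∷ []) ⊎ Any IsChild B
      reshape (inj₁ ¬r)        = inj₁ (here ¬r)
      reshape (inj₂ (inj₁ ¬q)) = inj₁ (there (here ¬q))
      reshape (inj₂ (inj₂ b))  = inj₂ b

    leafPair-vanishing : length (hits S) ≢ 0 → choose₂ ℓ * leafPairCount ≡ 0
    leafPair-vanishing len≢0 = choose₂*-vanishing ℓ (leafPair-wrong (hits-nonempty⇒any S (n≢0⇒n>0 len≢0)))

    leafNode-vanishing : length (hits S) ≢ 1 → ℓ * sumSelect₁ leafNodeCount S ≡ 0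
    leafNode-vanishing len≢1 = *-vanishing ℓ λ ℓ≥1 → sumSelect₁-vanishing leafNodeCount S λ B s perm → leafNode-wrong B s perm (wrong perm) ℓ≥1
      where
      wrong : ∀ {B s} → S ↭ s ∷ B → ¬ IsChild s ⊎ Any IsChild B
      wrong {B} {s} perm with isChild? s
      ... | no ¬child = inj₁ ¬child
      ... | yes child = inj₂ (hits-nonempty⇒any B (n≢0⇒n>0 λ len≡0 → len≢1 (trans (length-hits-↭∷ perm child) (cong suc len≡0))))

    nodePair-vanishing : length (hits S) ≢ 2 → sumSelect₂ nodePairCount S ≡ 0
    nodePair-vanishing len≢2 = sumSelect₂-vanishing nodePairCount S λ B r q perm → nodePair-wrong B r q perm (wrong perm)
      where
      wrong : ∀ {B r q} → S ↭ r ∷ q ∷ B → ¬ IsChild r ⊎ ¬ IsChild q ⊎ Any IsChild B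
      wrong {B} {r} {q} perm with isChild? r | isChild? q
      ... | no ¬child | _         = inj₁ ¬child
      ... | yes _     | no ¬child = inj₂ (inj₁ ¬child)
      ... | yes cr    | yes cq    = inj₂ (inj₂ (hits-nonempty⇒any B (n≢0⇒n>0 λ len≡0 →
                                      len≢2 (trans (length-hits-↭∷∷ perm cr cq) (cong (suc ∘ suc) len≡0)))))

    cong₃-+0 : ∀ {a b c d} → a ≡ 0 → b ≡ 0 → c ≡ d → a + b + c ≡ d
    cong₃-+0 refl refl refl = refl

    budget′ : ∀ {k} → childCount lab ≡ k → ℓ + (k + childrenBelow lab) ≡ 2 * suc f
    budget′ e = subst (λ x → ℓ + (x + childrenBelow lab) ≡ 2 * suc f) e budget

    ¬Binary-step : childCount lab ≤ 2 → ¬ Binary (suc lab) → ¬ Binary lab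
    ¬Binary-step ≤2 ¬bin bin = ¬bin (Binary-up lab bin ≤2)

    noChildren : hits S ≡ [] → CountLaw (suc f) ℓ S acc
    noChildren hits≡ = law
      where
      cc≡0 : childCount lab ≡ 0
      cc≡0 = trans (sym children) (cong length hits≡)
      count≡ : countFrom (suc f) ℓ S acc ≡ choose₂ ℓ * leafPairCount
      count≡ = trans expansion (trans (cong₂ (λ u v → choose₂ ℓ * leafPairCount + u + v)
                 (leafNode-vanishing (λ e → 0≢1+n (trans (cong length (sym hits≡)) e)))
                 (nodePair-vanishing (λ e → 0≢1+n (trans (cong length (sym hits≡)) e))))
               (trans (+-identityʳ _) (+-identityʳ _)))
      law : CountLaw (suc f) ℓ S acc
      law with 2 ≤? ℓ
      ... | no ℓ≱2 = (λ bin → ⊥-elim (ℓ≱2 (leafPair-leaves ℓ _ f (budget′ cc≡0) (childrenBelow-bound f (Binary-down lab bin)))))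
                   , (λ _ → trans count≡ (cong (_* leafPairCount) (choose₂-vanishing ℓ≱2)))
      ... | yes ℓ≥2 = (λ bin → trans (cong₂ (λ x k → x * 2 ^ (isZero k + cherriesBelow lab)) count≡ cc≡0)
                                      (choose₂-factorial ℓ leafPairCount (2 ^ cherriesBelow lab) ℓ≥2 (proj₁ ih′ (Binary-down lab bin))))
                    , (λ ¬bin → trans count≡ (trans (cong (choose₂ ℓ *_) (proj₂ ih′ (¬Binary-step (subst (_≤ 2) (sym cc≡0) z≤n) ¬bin)))
                                                    (*-zeroʳ (choose₂ ℓ))))
        where
        ih′ : CountLaw f (ℓ ∸ 2) (S ++ [ lab ]) acc
        ih′ = ih (WellFormed-leafPair st lab≥1 ℓ≥2)
                 (subst (Agrees lab (S ++ [ lab ])) (++-identityʳ acc) (Agrees-merge [] S st prefl ag [] (All.tabulate (hits≡[]⇒none S hits≡))))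
                 (leafPair-budget ℓ _ f (budget′ cc≡0) ℓ≥2)

    oneChild : ∀ r → hits S ≡ r ∷ [] → CountLaw (suc f) ℓ S acc
    oneChild r hits≡ = law
      where
      cc≡1 : childCount lab ≡ 1
      cc≡1 = trans (sym children) (cong length hits≡)
      r∈ : r ∈ S × IsChild r
      r∈ = ∈-hits⁻ S (subst (r ∈_) (sym hits≡) (here refl))
      count≡ : countFrom (suc f) ℓ S acc ≡ ℓ * sumSelect₁ leafNodeCount S
      count≡ = trans expansion (trans (cong₂ (λ u v → u + ℓ * sumSelect₁ leafNodeCount S + v)
                 (leafPair-vanishing (λ e → 1+n≢0 (trans (cong length (sym hits≡)) e)))
                 (nodePair-vanishing (λ e → 0≢1+n (suc-injective (trans (cong length (sym hits≡)) e)))))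
               (+-identityʳ _))
      law : CountLaw (suc f) ℓ S acc
      law with 1 ≤? ℓ
      ... | no ℓ≱1 = (λ bin → ⊥-elim (ℓ≱1 (leafNode-leaves ℓ _ f (budget′ cc≡1) (childrenBelow-bound f (Binary-down lab bin)))))
                   , (λ _ → trans count≡ (*-vanishing ℓ (λ ℓ≥1 → ⊥-elim (ℓ≱1 ℓ≥1))))
      ... | yes ℓ≥1 = (λ bin → trans (cong₂ (λ x k → x * 2 ^ (isZero k + cherriesBelow lab)) count≡′ cc≡1)
                                      (*-factorial ℓ (leafNodeCount (misses S) r) (2 ^ cherriesBelow lab) ℓ≥1 (proj₁ ih′ (Binary-down lab bin))))
                    , (λ ¬bin → trans count≡′ (trans (cong (ℓ *_) (proj₂ ih′ (¬Binary-step (subst (_≤ 2) (sym cc≡1) (s≤s z≤n)) ¬bin))) (*-zeroʳ ℓ)))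
        where
        count≡′ : countFrom (suc f) ℓ S acc ≡ ℓ * leafNodeCount (misses S) r
        count≡′ = trans count≡ (cong (ℓ *_) (sumSelect₁-single-hit leafNodeCount S r hits≡ (λ B x perm wrong → leafNode-wrong B x perm wrong ℓ≥1)))
        perm : S ↭ r ∷ misses S
        perm = hits≡⇒↭++misses S (r ∷ []) hits≡
        ih′ : CountLaw f (pred ℓ) (misses S ++ [ lab ]) (acc ++ [ (r , lab) ])
        ih′ = ih (WellFormed-leafNode st lab≥1 perm ℓ≥1)
                 (Agrees-merge (r ∷ []) (misses S) st perm ag (proj₂ r∈ ∷ []) (all-misses S))
                 (leafNode-budget ℓ _ f (budget′ cc≡1) ℓ≥1)

    twoChildren : ∀ r q → hits S ≡ r ∷ q ∷ [] → CountLaw (suc f) ℓ S acc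
    twoChildren r q hits≡ = law
      where
      cc≡2 : childCount lab ≡ 2
      cc≡2 = trans (sym children) (cong length hits≡)
      r∈ : r ∈ S × IsChild r
      r∈ = ∈-hits⁻ S (subst (r ∈_) (sym hits≡) (here refl))
      q∈ : q ∈ S × IsChild q
      q∈ = ∈-hits⁻ S (subst (q ∈_) (sym hits≡) (there (here refl)))
      perm : S ↭ r ∷ q ∷ misses S
      perm = hits≡⇒↭++misses S (r ∷ q ∷ []) hits≡
      count≡ : countFrom (suc f) ℓ S acc ≡ nodePairCount (misses S) r q
      count≡ = trans expansion (cong₃-+0 (leafPair-vanishing (λ e → 1+n≢0 (trans (cong length (sym hits≡)) e)))
                 (leafNode-vanishing (λ e → 1+n≢0 (suc-injective (trans (cong length (sym hits≡)) e))))
                 (sumSelect₂-two-hits nodePairCount S r q hits≡ nodePair-wrong))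
      ih′ : CountLaw f ℓ (misses S ++ [ lab ]) (acc ++ (r , lab) ∷ (q , lab) ∷ [])
      ih′ = ih (WellFormed-nodePair st lab≥1 perm)
               (Agrees-merge (r ∷ q ∷ []) (misses S) st perm ag (proj₂ r∈ ∷ proj₂ q∈ ∷ []) (all-misses S))
               (nodePair-budget ℓ _ f (budget′ cc≡2))
      law : CountLaw (suc f) ℓ S acc
      law = (λ bin → trans (cong₂ (λ x k → x * 2 ^ (isZero k + cherriesBelow lab)) count≡ cc≡2) (proj₁ ih′ (Binary-down lab bin)))
          , (λ ¬bin → trans count≡ (proj₂ ih′ (¬Binary-step (subst (_≤ 2) (sym cc≡2) ≤-refl) ¬bin)))

    manyChildren : ∀ r q t rest → hits S ≡ r ∷ q ∷ t ∷ rest → CountLaw (suc f) ℓ S acc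
    manyChildren r q t rest hits≡ = (λ bin → ⊥-elim (>2 (bin lab ≤-refl))) , (λ _ → count≡0)
      where
      len≡ : length (hits S) ≡ 3 + length rest
      len≡ = cong length hits≡
      >2 : ¬ childCount lab ≤ 2
      >2 ≤2 = 1+n≰n (≤-trans (s≤s (s≤s (s≤s z≤n))) (subst (_≤ 2) (trans (sym children) len≡) ≤2))
      count≡0 : countFrom (suc f) ℓ S acc ≡ 0
      count≡0 = trans expansion (cong₃-+0 (leafPair-vanishing (λ e → 1+n≢0 (trans (sym len≡) e)))
                  (leafNode-vanishing (λ e → 1+n≢0 (suc-injective (trans (sym len≡) e))))
                  (nodePair-vanishing (λ e → 1+n≢0 (suc-injective (suc-injective (trans (sym len≡) e))))))

    -- The number of children of lab among S decides which kind of merger can still lead to ps.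
    countLaw : CountLaw (suc f) ℓ S acc
    countLaw with hits S in hits≡
    ... | []               = noChildren hits≡
    ... | r ∷ []           = oneChild r hits≡
    ... | r ∷ q ∷ []       = twoChildren r q hits≡
    ... | r ∷ q ∷ t ∷ rest = manyChildren r q t rest hits≡

  count-agreeing : ∀ f → AgreeingCount f
  count-agreeing zero    = count-agreeing-final
  count-agreeing (suc f) st ag budget = Step.countLaw f st ag budget (count-agreeing f)

module PerTree (m : ℕ) (ps : List ℕ) (ps∈ : ps ∈ candidates m) where
  open States m
  open Target m ps ps∈
  open Production m ps ps∈
  open RunCount producesTarget?

  ps<n : ∀ {x} → x ∈ ps → x < n
  ps<n {x} x∈ with ∈-map⁻ par (subst (x ∈_) ps≡map-par x∈)
  ... | c , c∈ , refl = let (2≤c , c≤) = ∈-range⁻ 2 (suc m) c∈ in ≤-trans (par< c (≤-trans (s≤s z≤n) 2≤c)) (≤-trans c≤ (n≤1+n _))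

  childrenBelow-all : childrenBelow n ≡ m
  childrenBelow-all = trans (countBelow-all n ps ps<n) length-ps

  initialBudget : n + childrenBelow n ≡ 2 * suc m
  initialBudget = trans (cong (n +_) childrenBelow-all) (regroup m)
    where
    regroup : ∀ m → suc (suc m) + m ≡ 2 * suc m
    regroup = solve-∀

  cherriesBelow≡cherries : ∀ K → cherriesBelow (suc K) ≡ cherries (suc K) ps
  cherriesBelow≡cherries zero    = refl
  cherriesBelow≡cherries (suc K) = begin
    isZero (childCount (suc K)) + cherriesBelow (suc K)   ≡⟨ cong₂ _+_ (isZero≡ (suc K)) (cherriesBelow≡cherries K) ⟩
    length (filter leaf? [ suc K ]) + length (filter leaf? (range 1 K))
      ≡⟨ +-comm (length (filter leaf? [ suc K ])) _ ⟩
    length (filter leaf? (range 1 K)) + length (filter leaf? [ suc K ])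
      ≡⟨ sym (trans (cong length (filter-++ leaf? (range 1 K) [ suc K ])) (length-++ (filter leaf? (range 1 K)))) ⟩
    length (filter leaf? (range 1 K ++ [ suc K ]))         ≡⟨ cong (λ xs → length (filter leaf? xs)) (sym (range-∷ʳ K (s≤s z≤n))) ⟩
    length (filter leaf? (range 1 (suc K)))                ∎
    where
    open ≡-Reasoning
    leaf? : (j : ℕ) → Dec (countℕ j ps ≡ 0)
    leaf? j = countℕ j ps ≟ 0
    isZero≡ : ∀ j → isZero (countℕ j ps) ≡ length (filter (λ j → countℕ j ps ≟ 0) [ j ])
    isZero≡ j with countℕ j ps
    ... | zero  = refl
    ... | suc _ = refl

  Binary⇒atMostTwo : Binary n → T (atMostTwoChildren ps)
  Binary⇒atMostTwo bin = AllProp.all⁻ (λ j → countℕ j ps ≤ᵇ 2) (All.tabulate λ {j} j∈ → ≤⇒≤ᵇ (bin j (ps<n j∈)))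

  atMostTwo⇒Binary : T (atMostTwoChildren ps) → Binary n
  atMostTwo⇒Binary atMostTwo c c<n with c ∈ℕ? ps
  ... | yes c∈ = ≤ᵇ⇒≤ (countℕ c ps) 2 (All.lookup (AllProp.all⁺ (λ j → countℕ j ps ≤ᵇ 2) ps atMostTwo) c∈)
  ... | no  c∉ = subst (_≤ 2) (sym (cong length (filter-none (c ≟_) (All.tabulate λ {x} x∈ c≡x → c∉ (subst (_∈ ps) (sym c≡x) x∈))))) z≤n

  runsToTarget : ℕ
  runsToTarget = length (filter producesTarget? (runs (suc m) (replicateL n) []))

  countLaw : CountLaw (suc m) n [] []
  countLaw = count-agreeing (suc m) WellFormed-initial ((λ ()) , (λ ())) initialBudget

  runsToTarget≡countFrom : runsToTarget ≡ countFrom (suc m) n [] []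
  runsToTarget≡countFrom = cong (λ rs → length (filter producesTarget? rs)) (runs≡state (suc m) n)

  runsToTarget-binary : T (atMostTwoChildren ps) → runsToTarget * 2 ^ cherries n ps ≡ n !
  runsToTarget-binary atMostTwo =
    trans (cong₂ (λ k o → k * 2 ^ o) runsToTarget≡countFrom (sym (cherriesBelow≡cherries (suc m))))
          (proj₁ countLaw (atMostTwo⇒Binary atMostTwo))

  runsToTarget-nonbinary : ¬ T (atMostTwoChildren ps) → runsToTarget ≡ 0
  runsToTarget-nonbinary ¬atMostTwo = trans runsToTarget≡countFrom (proj₂ countLaw (¬atMostTwo ∘ Binary⇒atMostTwo))

-- The probability of identical trees

length-filter≡0⇒none : {P : Pred A 0ℓ} (P? : Decidable P) (xs : List A) → length (filter P? xs) ≡ 0 → ∀ {x} → x ∈ xs → ¬ P x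
length-filter≡0⇒none P? (y ∷ xs) len≡0 x∈ px with P? y
length-filter≡0⇒none P? (y ∷ xs) ()    x∈          px | yes _
length-filter≡0⇒none P? (y ∷ xs) len≡0 (here refl) px | no ¬py = ¬py px
length-filter≡0⇒none P? (y ∷ xs) len≡0 (there x∈)  px | no _   = length-filter≡0⇒none P? xs len≡0 x∈ px

length-concatMap : (f : A → List B) (xs : List A) → length (concatMap f xs) ≡ sum (map (λ x → length (f x)) xs)
length-concatMap f []       = refl
length-concatMap f (x ∷ xs) = trans (length-++ (f x)) (cong (length (f x) +_) (length-concatMap f xs))

module Occurrences {A : Set} (_≟A_ : DecidableEquality A) where

  occ : A → List A → ℕ
  occ a xs = length (filter (a ≟A_) xs)

  occ-∷ : ∀ a x xs → occ a (x ∷ xs) ≡ occ a [ x ] + occ a xs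
  occ-∷ a x xs with a ≟A x
  ... | yes _ = refl
  ... | no  _ = refl

  occ-map : {B : Set} (f : B → A) (t : A) (xs : List B) → occ t (map f xs) ≡ length (filter (λ r → f r ≟A t) xs)
  occ-map f t []       = refl
  occ-map f t (x ∷ xs) with t ≟A f x | f x ≟A t
  ... | yes _  | yes _  = cong suc (occ-map f t xs)
  ... | no  _  | no  _  = occ-map f t xs
  ... | yes e  | no ¬e  = ⊥-elim (¬e (sym e))
  ... | no ¬e  | yes e  = ⊥-elim (¬e (sym e))

  occ-unique : ∀ {a xs} → Unique xs → a ∈ xs → occ a xs ≡ 1
  occ-unique {a} (a∉ ∷ u) (here refl) =
    trans (cong length (filter-accept (a ≟A_) refl)) (cong suc (cong length (filter-none (a ≟A_) a∉)))
  occ-unique {a} {x ∷ xs} (x∉ ∷ u) (there a∈) =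
    trans (cong length (filter-reject (a ≟A_) (λ a≡x → All.lookup x∉ a∈ (sym a≡x)))) (occ-unique u a∈)

  sum-occ-[] : (h : A → ℕ) (a : A) (C : List A) → sum (map (λ t → occ t [ a ] * h t) C) ≡ occ a C * h a
  sum-occ-[] h a []      = refl
  sum-occ-[] h a (t ∷ C) with t ≟A a | a ≟A t
  ... | yes refl | yes _  = trans (cong (h a + 0 +_) (sum-occ-[] h a C)) (cong (_+ occ a C * h a) (+-identityʳ (h a)))
  ... | no  _    | no  _  = sum-occ-[] h a C
  ... | yes e    | no ¬e  = ⊥-elim (¬e (sym e))
  ... | no ¬e    | yes e  = ⊥-elim (¬e (sym e))

  sum≡sum-occ : (C : List A) → Unique C → (h : A → ℕ) (xs : List A) → (∀ {a} → a ∈ xs → a ∈ C) →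
                sum (map h xs) ≡ sum (map (λ t → occ t xs * h t) C)
  sum≡sum-occ C uC h []       _    = sym (zeros C)
    where
    zeros : ∀ C → sum (map (λ (_ : A) → 0) C) ≡ 0
    zeros []      = refl
    zeros (_ ∷ C) = zeros C
  sum≡sum-occ C uC h (a ∷ xs) ⊆C = begin
    h a + sum (map h xs)
      ≡⟨ cong₂ _+_ (sym (trans (sum-occ-[] h a C) (trans (cong (_* h a) (occ-unique uC (⊆C (here refl)))) (+-identityʳ (h a)))))
                   (sum≡sum-occ C uC h xs (λ a∈ → ⊆C (there a∈))) ⟩
    sum (map (λ t → occ t [ a ] * h t) C) + sum (map (λ t → occ t xs * h t) C)
      ≡⟨ sym (sum-map-+ _ _ C) ⟩
    sum (map (λ t → occ t [ a ] * h t + occ t xs * h t) C)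
      ≡⟨ sum-map-cong (λ t → trans (sym (*-distribʳ-+ (h t) (occ t [ a ]) (occ t xs))) (cong (_* h t) (sym (occ-∷ t a xs)))) C ⟩
    sum (map (λ t → occ t (a ∷ xs) * h t) C) ∎
    where open ≡-Reasoning

Unique-candidates : ∀ m → Unique (candidates m)
Unique-candidates zero    = [] ∷ []
Unique-candidates (suc m) =
  UP.concat⁺ (AllProp.map⁺ (All.tabulate λ _ → UP.map⁺ (λ e → proj₂ (∷ʳ-injective _ _ e)) (Unique-range 1 (suc m))))
             (APProp.map⁺ (AP.map disjoint (Unique-candidates m)))
  where
  disjoint : ∀ {ps ps′} → ps ≢ ps′ → Disjoint (map (λ p → ps ++ [ p ]) (range 1 (suc m))) (map (λ p → ps′ ++ [ p ]) (range 1 (suc m)))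
  disjoint ps≢ps′ (v∈ , v∈′) with ∈-map⁻ _ v∈ | ∈-map⁻ _ v∈′
  ... | p , _ , refl | p′ , _ , e = ps≢ps′ (proj₁ (∷ʳ-injective _ _ e))

totalRuns : ℕ → ℕ → ℕ
totalRuns zero    k = 1
totalRuns (suc f) k = choose₂ k * totalRuns f (k ∸ 1)

sumSelect₁-length : (h : ℕ → ℕ) (xs : List A) → sumSelect₁ (λ B _ → h (length B)) xs ≡ length xs * h (pred (length xs))
sumSelect₁-length h []       = refl
sumSelect₁-length h (x ∷ xs) = cong (h (length xs) +_) (trans (sumSelect₁-length (λ k → h (suc k)) xs) (pred-suc (length xs)))
  where
  pred-suc : ∀ k → k * h (suc (pred k)) ≡ k * h k
  pred-suc zero    = refl
  pred-suc (suc k) = refl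

sumSelect₂-length : (h : ℕ → ℕ) (xs : List A) → sumSelect₂ (λ B _ _ → h (length B)) xs ≡ choose₂ (length xs) * h (length xs ∸ 2)
sumSelect₂-length h []       = refl
sumSelect₂-length h (x ∷ xs) = trans (cong₂ _+_ (sumSelect₁-length h xs) (sumSelect₂-length (λ k → h (suc k)) xs)) (collect (length xs))
  where
  collect : ∀ k → k * h (pred k) + choose₂ k * h (suc (k ∸ 2)) ≡ (k + choose₂ k) * h (k ∸ 1)
  collect zero          = refl
  collect (suc zero)    = +-identityʳ _
  collect (suc (suc k)) = sym (*-distribʳ-+ (h (suc k)) (suc (suc k)) (choose₂ (suc (suc k))))

module AllRuns = RunCount {Q = λ (_ : List (ℕ × ℕ)) → ⊤} (λ _ → yes tt)

length-runs : ∀ f ls acc → length (runs f ls acc) ≡ totalRuns f (length ls)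
length-runs f ls acc = trans (sym (cong length (filter-all (λ _ → yes tt) (All.universal (λ _ → tt) (runs f ls acc))))) (countRuns-total f ls acc)
  where
  countRuns-total : ∀ f ls acc → AllRuns.countRuns f ls acc ≡ totalRuns f (length ls)
  countRuns-total zero    ls acc = refl
  countRuns-total (suc f) ls acc = begin
    AllRuns.countRuns (suc f) ls acc
      ≡⟨ AllRuns.countRuns-suc f ls acc ⟩
    sumSelect₂ (λ B a b → AllRuns.countRuns f (B ++ [ nodeL (length ls ∸ 1) ]) (acc ++ edgeOf a (length ls ∸ 1) ++ edgeOf b (length ls ∸ 1))) ls
      ≡⟨ sumSelect₂-cong (λ B a b → trans (countRuns-total f _ _) (cong (totalRuns f) (trans (length-++ B) (+-comm (length B) 1)))) ls ⟩
    sumSelect₂ (λ B _ _ → totalRuns f (suc (length B))) ls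
      ≡⟨ sumSelect₂-length (λ k → totalRuns f (suc k)) ls ⟩
    choose₂ (length ls) * totalRuns f (suc (length ls ∸ 2))
      ≡⟨ realign (length ls) ⟩
    choose₂ (length ls) * totalRuns f (length ls ∸ 1) ∎
    where
    open ≡-Reasoning
    realign : ∀ k → choose₂ k * totalRuns f (suc (k ∸ 2)) ≡ choose₂ k * totalRuns f (k ∸ 1)
    realign zero          = refl
    realign (suc zero)    = refl
    realign (suc (suc k)) = refl

totalRuns-closed : ∀ f → 2 ^ f * totalRuns f (suc f) ≡ suc f ! * f !
totalRuns-closed zero    = refl
totalRuns-closed (suc f) = begin
  2 ^ suc f * (choose₂ (suc (suc f)) * totalRuns f (suc f))  ≡⟨ regroup (2 ^ f) (choose₂ (suc (suc f))) (totalRuns f (suc f)) ⟩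
  2 * choose₂ (suc (suc f)) * (2 ^ f * totalRuns f (suc f))  ≡⟨ cong₂ _*_ (2*choose₂ (suc f)) (totalRuns-closed f) ⟩
  suc (suc f) * suc f * (suc f ! * f !)                      ≡⟨ regroup′ (suc (suc f)) (suc f) (suc f !) (f !) ⟩
  suc (suc f) * suc f ! * (suc f * f !)                      ∎
  where
  open ≡-Reasoning
  regroup : ∀ x t r → 2 * x * (t * r) ≡ 2 * t * (x * r)
  regroup = solve-∀
  regroup′ : ∀ a b c d → a * b * (c * d) ≡ a * c * (b * d)
  regroup′ = solve-∀


-- p = a / b with b ≠ 0, the denominator of mkℚᵘ being stored minus one.
IsRatio : ℚ → ℕ → ℕ → Set
IsRatio p a b = Σ ℕ λ b′ → b ≡ suc b′ × toℚᵘ p ≃ᵘ mkℚᵘ (ℤ.+ a) b′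

IsRatio-÷ : ∀ a b → b ≢ 0 → IsRatio (a ÷ℕ b) a b
IsRatio-÷ a zero    b≢0 = ⊥-elim (b≢0 refl)
IsRatio-÷ a (suc b) _   = b , refl , toℚᵘ-fromℚᵘ (mkℚᵘ (ℤ.+ a) b)

IsRatio-* : ∀ {p q a b c d} → IsRatio p a b → IsRatio q c d → IsRatio (p ℚ.* q) (a * c) (b * d)
IsRatio-* {p} {q} {a} {_} {c} (b , refl , p≃) (d , refl , q≃) = _ , refl ,
  ≃-trans (toℚᵘ-homo-* p q) (≃-trans (*-cong p≃ q≃) (≃-reflexive (cong (λ z → mkℚᵘ z (d + b * suc d)) (sym (pos-* a c)))))

IsRatio-+ : ∀ {p q a b c d} → IsRatio p a b → IsRatio q c d → IsRatio (p ℚ.+ q) (a * d + c * b) (b * d)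
IsRatio-+ {p} {q} {a} {_} {c} (b , refl , p≃) (d , refl , q≃) = _ , refl , ≃-trans (toℚᵘ-homo-+ p q) (≃-trans (+-cong p≃ q≃)
  (≃-reflexive (cong (λ z → mkℚᵘ z (d + b * suc d))
    (sym (trans (pos-+ (a * suc d) (c * suc b)) (cong₂ ℤ._+_ (pos-* a (suc d)) (pos-* c (suc b))))))))

IsRatio-rescale : ∀ {p a b c d} → IsRatio p a b → a * d ≡ c * b → d ≢ 0 → IsRatio p c d
IsRatio-rescale {d = zero}  _                 _ d≢0 = ⊥-elim (d≢0 refl)
IsRatio-rescale {a = a} {c = c} {d = suc d} (b , refl , p≃) e _ =
  d , refl , ≃-trans p≃ (*≡* (trans (sym (pos-* a (suc d))) (trans (cong ℤ.+_ e) (pos-* c (suc b)))))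

IsRatio-unique : ∀ {p q a b} → IsRatio p a b → IsRatio q a b → p ≡ q
IsRatio-unique (b , refl , p≃) (.b , refl , q≃) = toℚᵘ-injective (≃-trans p≃ (≃-sym q≃))

IsRatio-^ : ∀ {x a b} → IsRatio x a b → ∀ o → IsRatio (x ^ℚ o) (a ^ o) (b ^ o)
IsRatio-^ r zero    = 0 , refl , ≃-refl
IsRatio-^ r (suc o) = IsRatio-* r (IsRatio-^ r o)

IsRatio-sum : (g : A → ℚ) (a : A → ℕ) (D : ℕ) (ts : List A) → D ≢ 0 →
  (∀ {t} → t ∈ ts → IsRatio (g t) (a t) D) → IsRatio (sumℚ (map g ts)) (sum (map a ts)) D
IsRatio-sum g a D []       D≢0 h = IsRatio-rescale {p = 0ℚ} {a = 0} {b = 1} (0 , refl , ≃-refl) refl D≢0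
IsRatio-sum g a D (t ∷ ts) D≢0 h =
  IsRatio-rescale (IsRatio-+ (h (here refl)) (IsRatio-sum g a D ts D≢0 (λ t∈ → h (there t∈)))) (regroup (a t) (sum (map a ts)) D) D≢0
  where
  regroup : ∀ x y D → (x * D + y * D) * D ≡ (x + y) * (D * D)
  regroup = solve-∀

sum-filter : {P : Pred A 0ℓ} (P? : Decidable P) (f : A → ℕ) (xs : List A) → (∀ {t} → t ∈ xs → ¬ P t → f t ≡ 0) →
             sum (map f xs) ≡ sum (map f (filter P? xs))
sum-filter P? f []       h = refl
sum-filter P? f (x ∷ xs) h with P? x
... | yes _  = cong (f x +_) (sum-filter P? f xs (λ t∈ → h (there t∈)))
... | no ¬px = trans (cong (_+ sum (map f xs)) (h (here refl) ¬px)) (sum-filter P? f xs (λ t∈ → h (there t∈)))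

atMostTwo? : (ps : List ℕ) → Dec (atMostTwoChildren ps ≡ true)
atMostTwo? ps = Bool._≟_ (atMostTwoChildren ps) true

module Final (m : ℕ) where
  open States m
  open Occurrences (≡-dec _≟_) public

  allRuns : List (List (ℕ × ℕ))
  allRuns = runs (suc m) (replicateL n) []

  outcomes : List (List ℕ)
  outcomes = coalescentOutcomes n

  N : ℕ
  N = length outcomes

  sameOutcome : ℕ
  sameOutcome = length (concatMap (λ a → filter (λ b → ≡-dec _≟_ a b) outcomes) outcomes)

  outcome∈candidates : ∀ {t} → t ∈ outcomes → t ∈ candidates m
  outcome∈candidates t∈ with ∈-map⁻ (treeOf n) t∈
  ... | r , r∈ , refl = decidable-stable (treeOf n r ∈? candidates m) (length-filter≡0⇒none (Outcomes.nonCandidate? m) allRuns none r∈)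
    where
    none : length (filter (Outcomes.nonCandidate? m) allRuns) ≡ 0
    none = trans (cong (λ rs → length (filter (Outcomes.nonCandidate? m) rs)) (runs≡state (suc m) n))
                 (Outcomes.count-nonCandidates m (suc m) WellFormed-initial)

  occ-outcomes : ∀ {t} (t∈ : t ∈ candidates m) → occ t outcomes ≡ PerTree.runsToTarget m t t∈
  occ-outcomes {t} _ = occ-map (treeOf n) t allRuns

  occ-rankedTree : ∀ {t} → t ∈ rankedTrees n → occ t outcomes * 2 ^ cherries n t ≡ n !
  occ-rankedTree {t} t∈ with ∈-filter⁻ atMostTwo? {xs = candidates m} t∈
  ... | t∈C , atMostTwo = trans (cong (_* 2 ^ cherries n t) (occ-outcomes t∈C)) (PerTree.runsToTarget-binary m t t∈C (Equivalence.from T-≡ atMostTwo))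

  sameOutcome≡ : sameOutcome ≡ sum (map (λ t → occ t outcomes * occ t outcomes) (rankedTrees n))
  sameOutcome≡ = begin
    sameOutcome                                                       ≡⟨ length-concatMap (λ a → filter (≡-dec _≟_ a) outcomes) outcomes ⟩
    sum (map (λ a → occ a outcomes) outcomes)                         ≡⟨ sum≡sum-occ (candidates m) (Unique-candidates m) (λ a → occ a outcomes) outcomes outcome∈candidates ⟩
    sum (map (λ t → occ t outcomes * occ t outcomes) (candidates m))  ≡⟨ sum-filter atMostTwo? _ (candidates m) nonbinary ⟩
    sum (map (λ t → occ t outcomes * occ t outcomes) (rankedTrees n)) ∎
    where
    open ≡-Reasoning
    nonbinary : ∀ {t} → t ∈ candidates m → atMostTwoChildren t ≢ true → occ t outcomes * occ t outcomes ≡ 0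
    nonbinary {t} t∈ ¬two = cong (λ k → k * k) (trans (occ-outcomes t∈) (PerTree.runsToTarget-nonbinary m t t∈ (¬two ∘ Equivalence.to T-≡)))

  length-outcomes : 2 ^ suc m * N ≡ n ! * suc m !
  length-outcomes = begin
    2 ^ suc m * N                              ≡⟨ cong (2 ^ suc m *_) (trans (length-map (treeOf n) allRuns) (length-runs (suc m) (replicateL n) [])) ⟩
    2 ^ suc m * totalRuns (suc m) (length (replicateL n))
      ≡⟨ cong (λ k → 2 ^ suc m * totalRuns (suc m) k) (trans (cong length (replicateL≡replicate n)) (length-replicate n)) ⟩
    2 ^ suc m * totalRuns (suc m) n            ≡⟨ totalRuns-closed (suc m) ⟩
    n ! * suc m !                              ∎
    where open ≡-Reasoning

  N≢0 : N ≢ 0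
  N≢0 N≡0 = *≢0 (n!≢0 n) (n!≢0 (suc m)) (trans (sym length-outcomes) (trans (cong (2 ^ suc m *_) N≡0) (*-zeroʳ (2 ^ suc m))))

  -- Common denominator of the terms of [z^{n-1}] Y(1/4, z).
  D : ℕ
  D = n ! * n ! * suc m !

  D≢0 : D ≢ 0
  D≢0 = *≢0 (*≢0 (n!≢0 n) (n!≢0 n)) (n!≢0 (suc m))

  coeffY-term : ∀ {t} → t ∈ rankedTrees n →
                IsRatio (((1 ÷ℕ 4) ^ℚ cherries n t) ℚ.* (1 ÷ℕ (suc m !))) (occ t outcomes * occ t outcomes) D
  coeffY-term {t} t∈ = IsRatio-rescale (IsRatio-* (IsRatio-^ (IsRatio-÷ 1 4 (λ ())) o) (IsRatio-÷ 1 (suc m !) (n!≢0 (suc m)))) cross D≢0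
    where
    c o : ℕ
    c = occ t outcomes
    o = cherries n t
    cross : 1 ^ o * 1 * D ≡ c * c * (4 ^ o * suc m !)
    cross = begin
      1 ^ o * 1 * (n ! * n ! * suc m !)              ≡⟨ cong₂ (λ u v → u * 1 * (v * v * suc m !)) (^-zeroˡ o) (sym (occ-rankedTree t∈)) ⟩
      1 * 1 * (c * 2 ^ o * (c * 2 ^ o) * suc m !)     ≡⟨ regroup c (2 ^ o) (suc m !) ⟩
      c * c * (2 ^ o * 2 ^ o * suc m !)               ≡⟨ cong (λ z → c * c * (z * suc m !)) (sym (4^≡2^*2^ o)) ⟩
      c * c * (4 ^ o * suc m !)                       ∎
      where
      open ≡-Reasoning
      regroup : ∀ c x M → 1 * 1 * (c * x * (c * x) * M) ≡ c * c * (x * x * M)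
      regroup = solve-∀

  sameOutcome-cross : sameOutcome * (suc m ! * D) ≡ 4 ^ suc m * sum (map (λ t → occ t outcomes * occ t outcomes) (rankedTrees n)) * (N * N)
  sameOutcome-cross = begin
    sameOutcome * (M * (F * F * M))    ≡⟨ cong (_* (M * (F * F * M))) sameOutcome≡ ⟩
    S * (M * (F * F * M))              ≡⟨ regroup S M F ⟩
    S * (F * M * (F * M))              ≡⟨ cong (λ z → S * (z * z)) (sym length-outcomes) ⟩
    S * (X * N * (X * N))              ≡⟨ regroup′ S X N ⟩
    X * X * S * (N * N)                ≡⟨ cong (λ z → z * S * (N * N)) (sym (4^≡2^*2^ (suc m))) ⟩
    4 ^ suc m * S * (N * N)            ∎
    where
    open ≡-Reasoning
    M F X S : ℕ
    M = suc m !
    F = n !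
    X = 2 ^ suc m
    S = sum (map (λ t → occ t outcomes * occ t outcomes) (rankedTrees n))
    regroup : ∀ S M F → S * (M * (F * F * M)) ≡ S * (F * M * (F * M))
    regroup = solve-∀
    regroup′ : ∀ S X N → S * (X * N * (X * N)) ≡ X * X * S * (N * N)
    regroup′ = solve-∀

proposition1 : (n : ℕ) → 2 ≤ n →
    pIdentical n ≡ ((4 ^ (n ∸ 1)) ÷ℕ ((n ∸ 1) !)) ℚ.* coeffY (1 ÷ℕ 4) (n ∸ 1)
proposition1 (suc zero)    (s≤s ())
proposition1 (suc (suc m)) _ =
  IsRatio-unique
    (IsRatio-rescale (IsRatio-÷ sameOutcome (N * N) (*≢0 N≢0 N≢0)) sameOutcome-cross (*≢0 (n!≢0 (suc m)) D≢0))
    (IsRatio-* (IsRatio-÷ (4 ^ suc m) (suc m !) (n!≢0 (suc m))) (IsRatio-sum _ _ D (rankedTrees (suc (suc m))) D≢0 coeffY-term))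
  where open Final m
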